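{- Let $m\ge2$ and $n\ge1$. Let $U_{m,n}\subset\mathbb{C}$ consist of points $x_1,\dots,x_m$ with $0<x_1<\dots<x_m$ real and points $y_j=ib_j$ with $0<b_1<\dots<b_n$ real. Let $A$ be the subposet of $\textsc{NC}(U_{m,n})$ consisting of all partitions in which $x_m$ is either a singleton block or lies in the same block as $x_{m-1}$. For each $k\in\{1,\dots,n\}$ let $B_k$ be the subposet of $\textsc{NC}(U_{m,n})$ consisting of all partitions in which $x_m$ lies in the same block as $y_k$ but not in the same block as any of $x_{m-1},y_1,\dots,y_{k-1}$. Then (1) $A$ is isomorphic to $\textsc{NC}(U_{m-1,n})\times\textsc{Bool}(1)$; (2) $B_k$ is isomorphic to $\textsc{NC}(U_{m-1,k-1})\times\textsc{Bool}(n-k)$; and $\textsc{NC}(U_{m,n})$ is the disjoint union of $A,B_1,\dots,B_n$.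
   Context: For a finite set $P\subset\mathbb{C}$, a partition of $P$ is noncrossing if the convex hulls of its blocks are pairwise disjoint; $\textsc{NC}(P)$ is the set of noncrossing partitions of $P$ ordered by refinement ($\pi\le\mu$ iff every block of $\mu$ is a union of blocks of $\pi$). For nonnegative $a,b$, $U_{a,b}$ denotes a configuration of $a$ points on the positive real axis and $b$ points on the positive imaginary axis (e.g. $U_{m-1,k-1}=\{x_1,\dots,x_{m-1},y_1,\dots,y_{k-1}\}$); the isomorphism type of $\textsc{NC}(U_{a,b})$ depends only on $a,b$. $\textsc{Bool}(k)$ is the lattice of subsets of $\{1,\dots,k\}$ under inclusion. Subposets carry the induced order; products carry the componentwise order.
   Formalization: The points $x_1,\dots,x_m$ and the heights $b_j$ are rational rather than real, and convex hulls are compared using rational weights. -}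

module Defs where

open import Level using (0ℓ)
open import Data.Bool using (Bool; true; false)
open import Data.Nat using (ℕ; zero; suc)
open import Data.Fin using (Fin; zero; suc; fromℕ; inject₁)
open import Data.Sum using (_⊎_; inj₁; inj₂)
open import Data.Product using (Σ; ∃; _×_; _,_; proj₁; proj₂)
open import Data.Empty using (⊥)
open import Relation.Nullary using (¬_)
open import Relation.Binary.PropositionalEquality
  using (_≡_; refl; sym; trans; cong)
open import Relation.Binary.Bundles using (Poset)
open import Relation.Binary.Morphism.Structures using (IsOrderIsomorphism)
import Relation.Binary.Construct.On as On
open import Data.Rational using (ℚ; 0ℚ; 1ℚ; _+_; _*_; _≤_; _<_)

-- Points of U_{a,b}: inj₁ i is x_{i+1} (on the positive real axis),
-- inj₂ j is y_{j+1} = i·b_{j+1} (on the positive imaginary axis).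

Pt : ℕ → ℕ → Set
Pt a b = Fin a ⊎ Fin b

-- coordinates in ℚ² ≅ ℂ (real part, imaginary part)
pos : ∀ {a b} → (Fin a → ℚ) → (Fin b → ℚ) → Pt a b → ℚ × ℚ
pos xs bs (inj₁ i) = xs i , 0ℚ
pos xs bs (inj₂ j) = 0ℚ , bs j

StrictlyIncreasingPos : ∀ {n} → (Fin n → ℚ) → Set
StrictlyIncreasingPos {n} f =
  (∀ i → 0ℚ < f i) × (∀ (i j : Fin n) → Data.Fin._<_ i j → f i < f j)

sumFin : ∀ {n} → (Fin n → ℚ) → ℚ
sumFin {zero}  f = 0ℚ
sumFin {suc n} f = f zero + sumFin (λ i → f (suc i))

sumPt : ∀ {a b} → (Pt a b → ℚ) → ℚ
sumPt f = sumFin (λ i → f (inj₁ i)) + sumFin (λ j → f (inj₂ j))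

-- set partitions of a finite set P, given by their (Boolean-valued)
-- "same block" equivalence relation

record Partition (P : Set) : Set where
  field
    rel     : P → P → Bool
    rel-refl  : ∀ p → rel p p ≡ true
    rel-sym   : ∀ p q → rel p q ≡ true → rel q p ≡ true
    rel-trans : ∀ p q r → rel p q ≡ true → rel q r ≡ true → rel p r ≡ true
open Partition public

-- the convex hull of the block of p meets the convex hull of the block
-- of q: some convex combination of the points of block(p) equals some
-- convex combination of the points of block(q)
HullsMeet : ∀ {a b} (xs : Fin a → ℚ) (bs : Fin b → ℚ) →
            Partition (Pt a b) → Pt a b → Pt a b → Set
HullsMeet xs bs π p q =
  Σ (Pt _ _ → ℚ) λ λ₁ → Σ (Pt _ _ → ℚ) λ λ₂ →
    (∀ r → 0ℚ ≤ λ₁ r) × (∀ r → rel π p r ≡ false → λ₁ r ≡ 0ℚ) × (sumPt λ₁ ≡ 1ℚ) ×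
    (∀ r → 0ℚ ≤ λ₂ r) × (∀ r → rel π q r ≡ false → λ₂ r ≡ 0ℚ) × (sumPt λ₂ ≡ 1ℚ) ×
    (sumPt (λ r → λ₁ r * proj₁ (pos xs bs r)) ≡ sumPt (λ r → λ₂ r * proj₁ (pos xs bs r))) ×
    (sumPt (λ r → λ₁ r * proj₂ (pos xs bs r)) ≡ sumPt (λ r → λ₂ r * proj₂ (pos xs bs r)))

NonCrossing : ∀ {a b} (xs : Fin a → ℚ) (bs : Fin b → ℚ) → Partition (Pt a b) → Set
NonCrossing xs bs π = ∀ p q → rel π p q ≡ false → ¬ HullsMeet xs bs π p q

module _ (P : Set) where
  _≈ᴾ_ : Partition P → Partition P → Set
  π ≈ᴾ μ = ∀ p q → rel π p q ≡ rel μ p q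

  _≤ᴾ_ : Partition P → Partition P → Set
  π ≤ᴾ μ = ∀ p q → rel π p q ≡ true → rel μ p q ≡ true

  PartPoset : Poset 0ℓ 0ℓ 0ℓ
  PartPoset = record
    { Carrier = Partition P
    ; _≈_ = _≈ᴾ_
    ; _≤_ = _≤ᴾ_
    ; isPartialOrder = record
      { isPreorder = record
        { isEquivalence = record
          { refl = λ p q → refl
          ; sym = λ e p q → sym (e p q)
          ; trans = λ e f p q → trans (e p q) (f p q) }
        ; reflexive = λ {π} {μ} e p q h → trans (sym (e p q)) h
        ; trans = λ f g p q h → g p q (f p q h) }
      ; antisym = λ {π} {μ} → antisym {π} {μ} }
    }
    where
    antisym : ∀ {π μ} → π ≤ᴾ μ → μ ≤ᴾ π → π ≈ᴾ μ
    antisym {π} {μ} f g p q with rel π p q in e1 | rel μ p q in e2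
    ... | true  | true  = refl
    ... | false | false = refl
    ... | true  | false = trans (sym (f p q e1)) e2
    ... | false | true  = trans (sym e1) (g p q e2)

SubPoset : (Q : Poset 0ℓ 0ℓ 0ℓ) → (Poset.Carrier Q → Set) → Poset 0ℓ 0ℓ 0ℓ
SubPoset Q S = On.poset Q (proj₁ {B = S})

NC : ∀ {a b} → (Fin a → ℚ) → (Fin b → ℚ) → Poset 0ℓ 0ℓ 0ℓ
NC {a} {b} xs bs = SubPoset (PartPoset (Pt a b)) (NonCrossing xs bs)

open import Data.Fin.Subset.Properties using (⊆-poset)
BoolPoset : ℕ → Poset 0ℓ 0ℓ 0ℓ
BoolPoset k = ⊆-poset k

open import Data.Product.Relation.Binary.Pointwise.NonDependent using (×-poset)
_×ᴾ_ : Poset 0ℓ 0ℓ 0ℓ → Poset 0ℓ 0ℓ 0ℓ → Poset 0ℓ 0ℓ 0ℓ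
P ×ᴾ Q = ×-poset P Q

_≅_ : Poset 0ℓ 0ℓ 0ℓ → Poset 0ℓ 0ℓ 0ℓ → Set
P ≅ Q = Σ (Poset.Carrier P → Poset.Carrier Q) λ f →
  IsOrderIsomorphism (Poset._≈_ P) (Poset._≈_ Q) (Poset._≤_ P) (Poset._≤_ Q) f

-- the pieces A and B_k of NC(U_{m,n}), with m = 2 + m', n = 1 + n'

module _ {m' n' : ℕ} where
  xLast xPrev : Pt (suc (suc m')) (suc n')
  xLast = inj₁ (fromℕ (suc m'))
  xPrev = inj₁ (inject₁ (fromℕ m'))

  yPt : Fin (suc n') → Pt (suc (suc m')) (suc n')
  yPt j = inj₂ j

  InA : Partition (Pt (suc (suc m')) (suc n')) → Set
  InA π = (∀ p → rel π xLast p ≡ true → p ≡ xLast) ⊎ (rel π xLast xPrev ≡ true)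

  -- k : Fin n stands for the index k+1 ∈ {1,…,n}:
  -- x_m is in the block of y_{k+1} but not of x_{m-1}, y_1, …, y_k
  InB : Fin (suc n') → Partition (Pt (suc (suc m')) (suc n')) → Set
  InB k π = (rel π xLast (yPt k) ≡ true) × (rel π xLast xPrev ≡ false) ×
            (∀ j → Data.Fin._<_ j k → rel π xLast (yPt j) ≡ false)

{-# OPTIONS --safe #-}
module Submission where

-- A partition in A or B_k is determined by its restriction to the points other
-- than x_m, y_k, …, y_n together with a little extra data: for A whether x_m is
-- joined to x_{m-1}; for B_k which consecutive pairs y_j, y_{j+1} (j ≥ k) are
-- joined, because noncrossingness forces x_m, y_k, …, y_n (with x_m in the block
-- of y_k) to split into intervals of that chain, none meeting a lower block.
-- Restriction preserves noncrossingness, since a witness that two hulls meet in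
-- the smaller configuration is one in the larger. Conversely every such datum
-- extends to a noncrossing partition: each pair of new blocks is separated by an
-- explicit line (through x_m vertically, through x_m and y_k, horizontally, or
-- through the extreme points of the block of x_{m-1}), and a linear functional
-- that is ≥ c on one block and < c on another separates their convex hulls.
-- The decomposition itself is read off from the first y_k joined to x_m.

open import Level using (0ℓ)
open import Data.Bool using (Bool; true; false)
open import Data.Bool.Properties using (not-¬; ¬-not; T-≡) renaming (_≟_ to _≟ᵇ_)
open import Data.Empty using (⊥; ⊥-elim)
open import Data.Nat as ℕ using (ℕ; zero; suc; z≤n; s≤s; _∸_)
import Data.Nat.Properties as ℕₚ
open import Data.Fin as F using (Fin; zero; suc; fromℕ; fromℕ<; inject₁; inject; toℕ)
import Data.Fin.Properties as Fₚ
open import Data.Fin.Subset using (Subset; _⊆_; _∈_)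
open import Data.Vec using (_∷_; []; here; tabulate; lookup)
import Data.Vec.Properties as Vₚ
open import Data.Product using (Σ; ∃; _×_; _,_; proj₁; proj₂)
open import Data.Sum using (_⊎_; inj₁; inj₂; [_,_]′)
open import Data.Rational hiding (pos)
open import Data.Rational.Properties
open import Function.Bundles using (Equivalence)
open import Relation.Nullary using (¬_; yes; no)
open import Relation.Nullary.Decidable using (dec⇒maybe)
open import Relation.Binary.Bundles using (Poset)
open import Relation.Binary.Definitions using (tri<; tri≈; tri>)
open import Relation.Binary.PropositionalEquality
open import Tactic.RingSolver using (solve-∀)
open import Tactic.RingSolver.Core.AlmostCommutativeRing
  using (AlmostCommutativeRing; fromCommutativeRing)

open import Defs

ℚ-ring : AlmostCommutativeRing 0ℓ 0ℓ
ℚ-ring = fromCommutativeRing +-*-commutativeRing (λ x → dec⇒maybe (0ℚ ≟ x))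

*-nonNeg : ∀ {p q} → 0ℚ ≤ p → 0ℚ ≤ q → 0ℚ ≤ p * q
*-nonNeg {p} {q} 0≤p 0≤q =
  nonNegative⁻¹ (p * q) {{nonNeg*nonNeg⇒nonNeg p {{nonNegative 0≤p}} q {{nonNegative 0≤q}}}}

*-pos : ∀ {p q} → 0ℚ < p → 0ℚ < q → 0ℚ < p * q
*-pos {p} {q} 0<p 0<q = positive⁻¹ (p * q) {{pos*pos⇒pos p {{positive 0<p}} q {{positive 0<q}}}}

*-monoʳ-≤-0≤ : ∀ {r p q} → 0ℚ ≤ r → p ≤ q → r * p ≤ r * q
*-monoʳ-≤-0≤ {r} 0≤r = *-monoˡ-≤-nonNeg r {{nonNegative 0≤r}}

*-monoʳ-<-0< : ∀ {r p q} → 0ℚ < r → p < q → r * p < r * q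
*-monoʳ-<-0< {r} 0<r = *-monoʳ-<-pos r {{positive 0<r}}

p<q⇒0<q-p : ∀ {p q} → p < q → 0ℚ < q - p
p<q⇒0<q-p {p} {q} p<q = subst (_< q - p) (+-inverseʳ p) (+-monoˡ-< (- p) p<q)

p<q⇒0≤q-p : ∀ {p q} → p < q → 0ℚ ≤ q - p
p<q⇒0≤q-p p<q = <⇒≤ (p<q⇒0<q-p p<q)

0<q-p⇒p<q : ∀ {p q} → 0ℚ < q - p → p < q
0<q-p⇒p<q {p} {q} 0<q-p = subst₂ _<_ (+-identityˡ p) (q-p+p≡q p q) (+-monoˡ-< p 0<q-p)
  where
  q-p+p≡q : ∀ p q → q - p + p ≡ q
  q-p+p≡q = solve-∀ ℚ-ring

strictly-increasing⇒≤ : ∀ {n} (f : Fin n → ℚ) → (∀ {i j} → i F.< j → f i < f j) →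
                        ∀ {i j} → ¬ (j F.< i) → f i ≤ f j
strictly-increasing⇒≤ f mono {i} {j} j≮i with Fₚ.<-cmp i j
... | tri< i<j _ _ = <⇒≤ (mono i<j)
... | tri≈ _ refl _ = ≤-refl
... | tri> _ _ j<i = ⊥-elim (j≮i j<i)

sumFin-cong : ∀ {n} {f g : Fin n → ℚ} → (∀ i → f i ≡ g i) → sumFin f ≡ sumFin g
sumFin-cong {zero}  f≗g = refl
sumFin-cong {suc n} f≗g = cong₂ _+_ (f≗g zero) (sumFin-cong (λ i → f≗g (suc i)))

sumFin-zero : ∀ {n} → sumFin {n} (λ _ → 0ℚ) ≡ 0ℚ
sumFin-zero {zero}  = refl
sumFin-zero {suc n} = trans (cong (0ℚ +_) (sumFin-zero {n})) (+-identityˡ 0ℚ)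

sumFin-+ : ∀ {n} (f g : Fin n → ℚ) → sumFin (λ i → f i + g i) ≡ sumFin f + sumFin g
sumFin-+ {zero}  f g = sym (+-identityˡ 0ℚ)
sumFin-+ {suc n} f g =
  trans (cong (f zero + g zero +_) (sumFin-+ (λ i → f (suc i)) (λ i → g (suc i))))
        (+-interchange (f zero) (g zero) _ _)
  where
  +-interchange : ∀ a b c d → a + b + (c + d) ≡ a + c + (b + d)
  +-interchange = solve-∀ ℚ-ring

sumFin-*ˡ : ∀ {n} (c : ℚ) (f : Fin n → ℚ) → sumFin (λ i → c * f i) ≡ c * sumFin f
sumFin-*ˡ {zero}  c f = sym (*-zeroʳ c)
sumFin-*ˡ {suc n} c f =
  trans (cong (c * f zero +_) (sumFin-*ˡ c (λ i → f (suc i)))) (sym (*-distribˡ-+ c (f zero) _))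

sumFin-mono-≤ : ∀ {n} {f g : Fin n → ℚ} → (∀ i → f i ≤ g i) → sumFin f ≤ sumFin g
sumFin-mono-≤ {zero}  f≤g = ≤-refl
sumFin-mono-≤ {suc n} f≤g = +-mono-≤ (f≤g zero) (sumFin-mono-≤ (λ i → f≤g (suc i)))

sumFin-nonNeg : ∀ {n} {f : Fin n → ℚ} → (∀ i → 0ℚ ≤ f i) → 0ℚ ≤ sumFin f
sumFin-nonNeg {n} {f} 0≤f = subst (_≤ sumFin f) (sumFin-zero {n}) (sumFin-mono-≤ 0≤f)

term≤sumFin : ∀ {n} {f : Fin n → ℚ} → (∀ i → 0ℚ ≤ f i) → ∀ j → f j ≤ sumFin f
term≤sumFin {suc n} {f} 0≤f zero =
  subst (_≤ sumFin f) (+-identityʳ (f zero)) (+-monoʳ-≤ (f zero) (sumFin-nonNeg (λ i → 0≤f (suc i))))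
term≤sumFin {suc n} {f} 0≤f (suc j) =
  subst (_≤ sumFin f) (+-identityˡ (f (suc j))) (+-mono-≤ (0≤f zero) (term≤sumFin (λ i → 0≤f (suc i)) j))

sumPt-cong : ∀ {a b} {f g : Pt a b → ℚ} → (∀ r → f r ≡ g r) → sumPt f ≡ sumPt g
sumPt-cong f≗g = cong₂ _+_ (sumFin-cong (λ i → f≗g (inj₁ i))) (sumFin-cong (λ j → f≗g (inj₂ j)))

sumPt-+ : ∀ {a b} (f g : Pt a b → ℚ) → sumPt (λ r → f r + g r) ≡ sumPt f + sumPt g
sumPt-+ f g =
  trans (cong₂ _+_ (sumFin-+ (λ i → f (inj₁ i)) (λ i → g (inj₁ i)))
                   (sumFin-+ (λ j → f (inj₂ j)) (λ j → g (inj₂ j))))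
        (+-interchange (sumFin (λ i → f (inj₁ i))) (sumFin (λ i → g (inj₁ i)))
                       (sumFin (λ j → f (inj₂ j))) (sumFin (λ j → g (inj₂ j))))
  where
  +-interchange : ∀ a b c d → a + b + (c + d) ≡ a + c + (b + d)
  +-interchange = solve-∀ ℚ-ring

sumPt-*ˡ : ∀ {a b} (c : ℚ) (f : Pt a b → ℚ) → sumPt (λ r → c * f r) ≡ c * sumPt f
sumPt-*ˡ c f =
  trans (cong₂ _+_ (sumFin-*ˡ c (λ i → f (inj₁ i))) (sumFin-*ˡ c (λ j → f (inj₂ j))))
        (sym (*-distribˡ-+ c _ _))

sumPt-mono-≤ : ∀ {a b} {f g : Pt a b → ℚ} → (∀ r → f r ≤ g r) → sumPt f ≤ sumPt g
sumPt-mono-≤ f≤g = +-mono-≤ (sumFin-mono-≤ (λ i → f≤g (inj₁ i))) (sumFin-mono-≤ (λ j → f≤g (inj₂ j)))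

term≤sumPt : ∀ {a b} {f : Pt a b → ℚ} → (∀ r → 0ℚ ≤ f r) → ∀ p → f p ≤ sumPt f
term≤sumPt {f = f} 0≤f (inj₁ i) =
  subst (_≤ sumPt f) (+-identityʳ (f (inj₁ i)))
    (+-mono-≤ (term≤sumFin (λ i → 0≤f (inj₁ i)) i) (sumFin-nonNeg (λ j → 0≤f (inj₂ j))))
term≤sumPt {f = f} 0≤f (inj₂ j) =
  subst (_≤ sumPt f) (+-identityˡ (f (inj₂ j)))
    (+-mono-≤ (sumFin-nonNeg (λ i → 0≤f (inj₁ i))) (term≤sumFin (λ j → 0≤f (inj₂ j)) j))

0<sumFin⇒∃0< : ∀ {n} (f : Fin n → ℚ) → 0ℚ < sumFin f → ∃ λ i → 0ℚ < f i
0<sumFin⇒∃0< {zero}  f 0<0 = ⊥-elim (<-irrefl refl 0<0)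
0<sumFin⇒∃0< {suc n} f 0<Σf with 0ℚ <? f zero | 0ℚ <? sumFin (λ i → f (suc i))
... | yes 0<f₀ | _     = zero , 0<f₀
... | no _     | yes 0<Σ = let i , 0<fᵢ = 0<sumFin⇒∃0< (λ i → f (suc i)) 0<Σ in suc i , 0<fᵢ
... | no 0≮f₀  | no 0≮Σ = ⊥-elim (<-irrefl refl (<-≤-trans 0<Σf
        (≤-trans (+-mono-≤ (≮⇒≥ 0≮f₀) (≮⇒≥ 0≮Σ)) (≤-reflexive (+-identityˡ 0ℚ)))))

0<sumPt⇒∃0< : ∀ {a b} (f : Pt a b → ℚ) → 0ℚ < sumPt f → ∃ λ r → 0ℚ < f r
0<sumPt⇒∃0< f 0<Σf with 0ℚ <? sumFin (λ i → f (inj₁ i)) | 0ℚ <? sumFin (λ j → f (inj₂ j))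
... | yes 0<Σx | _ = let i , 0<fᵢ = 0<sumFin⇒∃0< _ 0<Σx in inj₁ i , 0<fᵢ
... | no _ | yes 0<Σy = let j , 0<fⱼ = 0<sumFin⇒∃0< _ 0<Σy in inj₂ j , 0<fⱼ
... | no 0≮Σx | no 0≮Σy = ⊥-elim (<-irrefl refl (<-≤-trans 0<Σf
        (≤-trans (+-mono-≤ (≮⇒≥ 0≮Σx) (≮⇒≥ 0≮Σy)) (≤-reflexive (+-identityˡ 0ℚ)))))

module Average {a b} (B : Pt a b → Bool) {l : Pt a b → ℚ}
                (0≤l : ∀ r → 0ℚ ≤ l r) (supp : ∀ r → B r ≡ false → l r ≡ 0ℚ)
                (Σl≡1 : sumPt l ≡ 1ℚ) where

  average-const : ∀ c → sumPt (λ r → l r * c) ≡ c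
  average-const c = begin
    sumPt (λ r → l r * c) ≡⟨ sumPt-cong {a} {b} (λ r → *-comm (l r) c) ⟩
    sumPt (λ r → c * l r) ≡⟨ sumPt-*ˡ c l ⟩
    c * sumPt l           ≡⟨ cong (c *_) Σl≡1 ⟩
    c * 1ℚ                ≡⟨ *-identityʳ c ⟩
    c                     ∎
    where open ≡-Reasoning

  average-≥ : ∀ {c} (f : Pt a b → ℚ) → (∀ r → B r ≡ true → c ≤ f r) → c ≤ sumPt (λ r → l r * f r)
  average-≥ {c} f c≤f = subst (_≤ sumPt (λ r → l r * f r)) (average-const c) (sumPt-mono-≤ termwise)
    where
    termwise : ∀ r → l r * c ≤ l r * f r
    termwise r with B r in Br
    ... | true  = *-monoʳ-≤-0≤ (0≤l r) (c≤f r Br)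
    ... | false rewrite supp r Br = ≤-reflexive (trans (*-zeroˡ c) (sym (*-zeroˡ (f r))))

  average-< : ∀ {c} (f : Pt a b → ℚ) → (∀ r → B r ≡ true → f r < c) → sumPt (λ r → l r * f r) < c
  average-< {c} f f<c = 0<q-p⇒p<q (subst (0ℚ <_) Σgap≡c-average 0<Σgap)
    where
    gap : Pt a b → ℚ
    gap r = l r * (c - f r)
    0≤gap : ∀ r → 0ℚ ≤ gap r
    0≤gap r with B r in Br
    ... | true  = *-nonNeg (0≤l r) (p<q⇒0≤q-p (f<c r Br))
    ... | false rewrite supp r Br = ≤-reflexive (sym (*-zeroˡ (c - f r)))
    0<Σgap : 0ℚ < sumPt gap
    0<Σgap with 0<sumPt⇒∃0< l (subst (0ℚ <_) (sym Σl≡1) (positive⁻¹ 1ℚ))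
    ... | r , 0<lr with B r in Br
    ...   | true  = <-≤-trans (*-pos 0<lr (p<q⇒0<q-p (f<c r Br))) (term≤sumPt 0≤gap r)
    ...   | false = ⊥-elim (<-irrefl (sym (supp r Br)) 0<lr)
    gap-split : ∀ l c f → l * (c - f) ≡ l * c + (- 1ℚ) * (l * f)
    gap-split = solve-∀ ℚ-ring
    minus-one : ∀ c s → c + (- 1ℚ) * s ≡ c - s
    minus-one = solve-∀ ℚ-ring
    Σgap≡c-average : sumPt gap ≡ c - sumPt (λ r → l r * f r)
    Σgap≡c-average = begin
      sumPt gap
        ≡⟨ sumPt-cong {a} {b} (λ r → gap-split (l r) c (f r)) ⟩
      sumPt (λ r → l r * c + (- 1ℚ) * (l r * f r))
        ≡⟨ sumPt-+ (λ r → l r * c) (λ r → (- 1ℚ) * (l r * f r)) ⟩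
      sumPt (λ r → l r * c) + sumPt (λ r → (- 1ℚ) * (l r * f r))
        ≡⟨ cong₂ _+_ (average-const c) (sumPt-*ˡ (- 1ℚ) (λ r → l r * f r)) ⟩
      c + (- 1ℚ) * sumPt (λ r → l r * f r)
        ≡⟨ minus-one c _ ⟩
      c - sumPt (λ r → l r * f r) ∎
      where open ≡-Reasoning

δ : ∀ {n} → Fin n → Fin n → ℚ
δ zero    zero    = 1ℚ
δ zero    (suc j) = 0ℚ
δ (suc i) zero    = 0ℚ
δ (suc i) (suc j) = δ i j

δ-nonNeg : ∀ {n} (i j : Fin n) → 0ℚ ≤ δ i j
δ-nonNeg zero    zero    = <⇒≤ (positive⁻¹ 1ℚ)
δ-nonNeg zero    (suc j) = ≤-refl
δ-nonNeg (suc i) zero    = ≤-refl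
δ-nonNeg (suc i) (suc j) = δ-nonNeg i j

δ-≢ : ∀ {n} {i j : Fin n} → i ≢ j → δ i j ≡ 0ℚ
δ-≢ {i = zero}  {zero}  i≢j = ⊥-elim (i≢j refl)
δ-≢ {i = zero}  {suc j} i≢j = refl
δ-≢ {i = suc i} {zero}  i≢j = refl
δ-≢ {i = suc i} {suc j} i≢j = δ-≢ (λ i≡j → i≢j (cong suc i≡j))

sumFin-δ : ∀ {n} (i : Fin n) (h : Fin n → ℚ) → sumFin (λ j → δ i j * h j) ≡ h i
sumFin-δ {suc n} zero h =
  trans (cong₂ _+_ (*-identityˡ (h zero))
                   (trans (sumFin-cong (λ j → *-zeroˡ (h (suc j)))) (sumFin-zero {n})))
        (+-identityʳ (h zero))
sumFin-δ {suc n} (suc i) h =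
  trans (cong₂ _+_ (*-zeroˡ (h zero)) (sumFin-δ i (λ j → h (suc j)))) (+-identityˡ (h (suc i)))

δᴾ : ∀ {a b} → Pt a b → Pt a b → ℚ
δᴾ (inj₁ i) (inj₁ j) = δ i j
δᴾ (inj₁ i) (inj₂ j) = 0ℚ
δᴾ (inj₂ i) (inj₁ j) = 0ℚ
δᴾ (inj₂ i) (inj₂ j) = δ i j

δᴾ-nonNeg : ∀ {a b} (p r : Pt a b) → 0ℚ ≤ δᴾ p r
δᴾ-nonNeg (inj₁ i) (inj₁ j) = δ-nonNeg i j
δᴾ-nonNeg (inj₁ i) (inj₂ j) = ≤-refl
δᴾ-nonNeg (inj₂ i) (inj₁ j) = ≤-refl
δᴾ-nonNeg (inj₂ i) (inj₂ j) = δ-nonNeg i j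

δᴾ-≢ : ∀ {a b} {p r : Pt a b} → p ≢ r → δᴾ p r ≡ 0ℚ
δᴾ-≢ {p = inj₁ i} {inj₁ j} p≢r = δ-≢ (λ i≡j → p≢r (cong inj₁ i≡j))
δᴾ-≢ {p = inj₁ i} {inj₂ j} p≢r = refl
δᴾ-≢ {p = inj₂ i} {inj₁ j} p≢r = refl
δᴾ-≢ {p = inj₂ i} {inj₂ j} p≢r = δ-≢ (λ i≡j → p≢r (cong inj₂ i≡j))

sumPt-δᴾ : ∀ {a b} (p : Pt a b) (h : Pt a b → ℚ) → sumPt (λ r → δᴾ p r * h r) ≡ h p
sumPt-δᴾ {a} {b} (inj₁ i) h =
  trans (cong₂ _+_ (sumFin-δ i (λ j → h (inj₁ j)))
                   (trans (sumFin-cong (λ j → *-zeroˡ (h (inj₂ j)))) (sumFin-zero {b})))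
        (+-identityʳ (h (inj₁ i)))
sumPt-δᴾ {a} {b} (inj₂ j) h =
  trans (cong₂ _+_ (trans (sumFin-cong (λ i → *-zeroˡ (h (inj₁ i)))) (sumFin-zero {a}))
                   (sumFin-δ j (λ i → h (inj₂ i))))
        (+-identityˡ (h (inj₂ j)))

pair : ∀ {a b} → ℚ → Pt a b → ℚ → Pt a b → Pt a b → ℚ
pair N₁ p₁ N₂ p₂ r = N₁ * δᴾ p₁ r + N₂ * δᴾ p₂ r

sumPt-pair : ∀ {a b} N₁ (p₁ : Pt a b) N₂ p₂ (h : Pt a b → ℚ) →
             sumPt (λ r → pair N₁ p₁ N₂ p₂ r * h r) ≡ N₁ * h p₁ + N₂ * h p₂
sumPt-pair {a} {b} N₁ p₁ N₂ p₂ h = begin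
  sumPt (λ r → pair N₁ p₁ N₂ p₂ r * h r)
    ≡⟨ sumPt-cong {a} {b} (λ r → distrib N₁ (δᴾ p₁ r) N₂ (δᴾ p₂ r) (h r)) ⟩
  sumPt (λ r → N₁ * (δᴾ p₁ r * h r) + N₂ * (δᴾ p₂ r * h r))
    ≡⟨ sumPt-+ (λ r → N₁ * (δᴾ p₁ r * h r)) (λ r → N₂ * (δᴾ p₂ r * h r)) ⟩
  sumPt (λ r → N₁ * (δᴾ p₁ r * h r)) + sumPt (λ r → N₂ * (δᴾ p₂ r * h r))
    ≡⟨ cong₂ _+_ (trans (sumPt-*ˡ N₁ (λ r → δᴾ p₁ r * h r)) (cong (N₁ *_) (sumPt-δᴾ p₁ h)))
                 (trans (sumPt-*ˡ N₂ (λ r → δᴾ p₂ r * h r)) (cong (N₂ *_) (sumPt-δᴾ p₂ h))) ⟩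
  N₁ * h p₁ + N₂ * h p₂ ∎
  where
  open ≡-Reasoning
  distrib : ∀ N₁ d₁ N₂ d₂ x → (N₁ * d₁ + N₂ * d₂) * x ≡ N₁ * (d₁ * x) + N₂ * (d₂ * x)
  distrib = solve-∀ ℚ-ring

rel-comm : ∀ {P : Set} (π : Partition P) p q → rel π p q ≡ rel π q p
rel-comm π p q with rel π p q in pq | rel π q p in qp
... | true  | true  = refl
... | false | false = refl
... | true  | false = ⊥-elim (not-¬ (rel-sym π p q pq) qp)
... | false | true  = ⊥-elim (not-¬ (rel-sym π q p qp) pq)

rel-block : ∀ {P : Set} (π : Partition P) p q r → rel π p q ≡ true → rel π p r ≡ rel π q r
rel-block π p q r pq with rel π p r in pr | rel π q r in qr
... | true  | true  = refl
... | false | false = refl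
... | true  | false = ⊥-elim (not-¬ (rel-trans π q p r (rel-sym π p q pq) pr) qr)
... | false | true  = ⊥-elim (not-¬ (rel-trans π p q r pq qr) pr)

pullback : ∀ {X Y : Set} → (X → Y) → Partition Y → Partition X
pullback h σ = record
  { rel       = λ p q → rel σ (h p) (h q)
  ; rel-refl  = λ p → rel-refl σ (h p)
  ; rel-sym   = λ p q → rel-sym σ (h p) (h q)
  ; rel-trans = λ p q r → rel-trans σ (h p) (h q) (h r)
  }

relᵘ : ∀ {X Y : Set} → Partition X → Partition Y → X ⊎ Y → X ⊎ Y → Bool
relᵘ σ τ (inj₁ x) (inj₁ x′) = rel σ x x′
relᵘ σ τ (inj₁ x) (inj₂ y)  = false
relᵘ σ τ (inj₂ y) (inj₁ x)  = false
relᵘ σ τ (inj₂ y) (inj₂ y′) = rel τ y y′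

_⊎ᴾ_ : ∀ {X Y : Set} → Partition X → Partition Y → Partition (X ⊎ Y)
σ ⊎ᴾ τ = record { rel = relᵘ σ τ ; rel-refl = refl′ ; rel-sym = sym′ ; rel-trans = trans′ }
  where
  refl′ : ∀ p → relᵘ σ τ p p ≡ true
  refl′ (inj₁ x) = rel-refl σ x
  refl′ (inj₂ y) = rel-refl τ y
  sym′ : ∀ p q → relᵘ σ τ p q ≡ true → relᵘ σ τ q p ≡ true
  sym′ (inj₁ x) (inj₁ x′) = rel-sym σ x x′
  sym′ (inj₂ y) (inj₂ y′) = rel-sym τ y y′
  trans′ : ∀ p q r → relᵘ σ τ p q ≡ true → relᵘ σ τ q r ≡ true → relᵘ σ τ p r ≡ true
  trans′ (inj₁ x) (inj₁ x′) (inj₁ x″) = rel-trans σ x x′ x″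
  trans′ (inj₂ y) (inj₂ y′) (inj₂ y″) = rel-trans τ y y′ y″
  trans′ (inj₁ x) (inj₁ x′) (inj₂ y) _ ()
  trans′ (inj₂ y) (inj₂ y′) (inj₁ x) _ ()

≡ᵇ-true⇒≡ : ∀ m n → (m ℕ.≡ᵇ n) ≡ true → m ≡ n
≡ᵇ-true⇒≡ m n m≡ᵇn = ℕₚ.≡ᵇ⇒≡ m n (Equivalence.from T-≡ m≡ᵇn)

≡⇒≡ᵇ-true : ∀ m n → m ≡ n → (m ℕ.≡ᵇ n) ≡ true
≡⇒≡ᵇ-true m n m≡n = Equivalence.to T-≡ (ℕₚ.≡⇒≡ᵇ m n m≡n)

discreteℕ : Partition ℕ
discreteℕ = record
  { rel       = ℕ._≡ᵇ_
  ; rel-refl  = λ n → ≡⇒≡ᵇ-true n n refl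
  ; rel-sym   = λ m n e → ≡⇒≡ᵇ-true n m (sym (≡ᵇ-true⇒≡ m n e))
  ; rel-trans = λ m n k e e′ → ≡⇒≡ᵇ-true m k (trans (≡ᵇ-true⇒≡ m n e) (≡ᵇ-true⇒≡ n k e′))
  }

-- Convex hulls in U_{a,b}

module Geometry {a b : ℕ} (xs : Fin a → ℚ) (bs : Fin b → ℚ) where

  re im : Pt a b → ℚ
  re r = proj₁ (pos xs bs r)
  im r = proj₂ (pos xs bs r)

  HullsMeet-sym : ∀ (π : Partition (Pt a b)) p q → HullsMeet xs bs π p q → HullsMeet xs bs π q p
  HullsMeet-sym π p q (l₁ , l₂ , 0≤l₁ , supp₁ , Σl₁ , 0≤l₂ , supp₂ , Σl₂ , re-eq , im-eq) =
    l₂ , l₁ , 0≤l₂ , supp₂ , Σl₂ , 0≤l₁ , supp₁ , Σl₁ , sym re-eq , sym im-eq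

  HullsMeet-resp : ∀ (π π′ : Partition (Pt a b)) → (∀ p q → rel π p q ≡ rel π′ p q) →
                   ∀ {p q} → HullsMeet xs bs π p q → HullsMeet xs bs π′ p q
  HullsMeet-resp π π′ π≈π′ {p} {q} (l₁ , l₂ , 0≤l₁ , supp₁ , Σl₁ , 0≤l₂ , supp₂ , Σl₂ , re-eq , im-eq) =
    l₁ , l₂ , 0≤l₁ , (λ r e → supp₁ r (trans (π≈π′ p r) e)) , Σl₁ ,
    0≤l₂ , (λ r e → supp₂ r (trans (π≈π′ q r) e)) , Σl₂ , re-eq , im-eq

  HullsMeet-block : ∀ (π : Partition (Pt a b)) p p′ q → rel π p p′ ≡ true →
                    HullsMeet xs bs π p q → HullsMeet xs bs π p′ q
  HullsMeet-block π p p′ q pp′ (l₁ , l₂ , 0≤l₁ , supp₁ , Σl₁ , 0≤l₂ , supp₂ , Σl₂ , re-eq , im-eq) =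
    l₁ , l₂ , 0≤l₁ , (λ r e → supp₁ r (trans (rel-block π p p′ r pp′) e)) , Σl₁ ,
    0≤l₂ , supp₂ , Σl₂ , re-eq , im-eq

  HullsMeet⇒rel : ∀ (π : Partition (Pt a b)) → NonCrossing xs bs π →
                  ∀ {p q} → HullsMeet xs bs π p q → rel π p q ≡ true
  HullsMeet⇒rel π nc {p} {q} meet with rel π p q in pq
  ... | true  = refl
  ... | false = ⊥-elim (nc p q pq meet)

  -- The common point is (N₁ p₁ + N₂ p₂) / (N₁ + N₂) = (M₁ q₁ + M₂ q₂) / (M₁ + M₂).
  segments-meet : (π : Partition (Pt a b)) {p₁ p₂ q₁ q₂ : Pt a b} →
    rel π p₁ p₂ ≡ true → rel π q₁ q₂ ≡ true →
    (N₁ N₂ M₁ M₂ : ℚ) → 0ℚ ≤ N₁ → 0ℚ ≤ N₂ → 0ℚ ≤ M₁ → 0ℚ ≤ M₂ →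
    0ℚ < N₁ + N₂ → M₁ + M₂ ≡ N₁ + N₂ →
    N₁ * re p₁ + N₂ * re p₂ ≡ M₁ * re q₁ + M₂ * re q₂ →
    N₁ * im p₁ + N₂ * im p₂ ≡ M₁ * im q₁ + M₂ * im q₂ →
    HullsMeet xs bs π p₁ q₁
  segments-meet π {p₁} {p₂} {q₁} {q₂} p₁p₂ q₁q₂ N₁ N₂ M₁ M₂ 0≤N₁ 0≤N₂ 0≤M₁ 0≤M₂ 0<N M≡N re-eq im-eq =
    w N₁ p₁ N₂ p₂ , w M₁ q₁ M₂ q₂ ,
    w-nonNeg N₁ p₁ N₂ p₂ 0≤N₁ 0≤N₂ , w-supp N₁ N₂ p₁p₂ , w-total N₁ p₁ N₂ p₂ refl ,
    w-nonNeg M₁ q₁ M₂ q₂ 0≤M₁ 0≤M₂ , w-supp M₁ M₂ q₁q₂ , w-total M₁ q₁ M₂ q₂ M≡N ,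
    w-barycentre re re-eq , w-barycentre im im-eq
    where
    N = N₁ + N₂
    N≢0 : NonZero N
    N≢0 = pos⇒nonZero N {{positive 0<N}}
    d : ℚ
    d = (1/ N) {{N≢0}}
    0≤d : 0ℚ ≤ d
    0≤d = <⇒≤ (positive⁻¹ d {{1/pos⇒pos N {{positive 0<N}}}})

    w : ℚ → Pt a b → ℚ → Pt a b → Pt a b → ℚ
    w L₁ r₁ L₂ r₂ r = d * pair L₁ r₁ L₂ r₂ r

    sumPt-w : ∀ L₁ r₁ L₂ r₂ (h : Pt a b → ℚ) →
              sumPt (λ r → w L₁ r₁ L₂ r₂ r * h r) ≡ d * (L₁ * h r₁ + L₂ * h r₂)
    sumPt-w L₁ r₁ L₂ r₂ h =
      trans (sumPt-cong {a} {b} (λ r → *-assoc d (pair L₁ r₁ L₂ r₂ r) (h r)))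
            (trans (sumPt-*ˡ d (λ r → pair L₁ r₁ L₂ r₂ r * h r))
                   (cong (d *_) (sumPt-pair L₁ r₁ L₂ r₂ h)))

    w-nonNeg : ∀ L₁ r₁ L₂ r₂ → 0ℚ ≤ L₁ → 0ℚ ≤ L₂ → ∀ r → 0ℚ ≤ w L₁ r₁ L₂ r₂ r
    w-nonNeg L₁ r₁ L₂ r₂ 0≤L₁ 0≤L₂ r =
      *-nonNeg 0≤d (subst (_≤ pair L₁ r₁ L₂ r₂ r) (+-identityˡ 0ℚ)
        (+-mono-≤ (*-nonNeg 0≤L₁ (δᴾ-nonNeg r₁ r)) (*-nonNeg 0≤L₂ (δᴾ-nonNeg r₂ r))))

    w-supp : ∀ L₁ L₂ {r₁ r₂} → rel π r₁ r₂ ≡ true → ∀ r → rel π r₁ r ≡ false → w L₁ r₁ L₂ r₂ r ≡ 0ℚ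
    w-supp L₁ L₂ {r₁} {r₂} r₁r₂ r r₁≁r = begin
      d * (L₁ * δᴾ r₁ r + L₂ * δᴾ r₂ r) ≡⟨ cong₂ (λ u v → d * (L₁ * u + L₂ * v)) (δᴾ-≢ r₁≢r) (δᴾ-≢ r₂≢r) ⟩
      d * (L₁ * 0ℚ + L₂ * 0ℚ)           ≡⟨ vanish d L₁ L₂ ⟩
      0ℚ                                ∎
      where
      open ≡-Reasoning
      vanish : ∀ d L₁ L₂ → d * (L₁ * 0ℚ + L₂ * 0ℚ) ≡ 0ℚ
      vanish = solve-∀ ℚ-ring
      r₁≢r : r₁ ≢ r
      r₁≢r refl = not-¬ (rel-refl π r₁) r₁≁r
      r₂≢r : r₂ ≢ r
      r₂≢r refl = not-¬ r₁r₂ r₁≁r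

    w-total : ∀ L₁ r₁ L₂ r₂ → L₁ + L₂ ≡ N → sumPt (w L₁ r₁ L₂ r₂) ≡ 1ℚ
    w-total L₁ r₁ L₂ r₂ L≡N = begin
      sumPt (w L₁ r₁ L₂ r₂)                       ≡⟨ sumPt-cong {f = w L₁ r₁ L₂ r₂} (λ r → sym (*-identityʳ _)) ⟩
      sumPt (λ r → w L₁ r₁ L₂ r₂ r * 1ℚ)          ≡⟨ sumPt-w L₁ r₁ L₂ r₂ (λ _ → 1ℚ) ⟩
      d * (L₁ * 1ℚ + L₂ * 1ℚ)                     ≡⟨ cong (d *_) (cong₂ _+_ (*-identityʳ L₁) (*-identityʳ L₂)) ⟩
      d * (L₁ + L₂)                               ≡⟨ cong (d *_) L≡N ⟩
      d * N                                       ≡⟨ *-comm d N ⟩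
      N * d                                       ≡⟨ *-inverseʳ N {{N≢0}} ⟩
      1ℚ                                          ∎
      where open ≡-Reasoning

    w-barycentre : ∀ h → N₁ * h p₁ + N₂ * h p₂ ≡ M₁ * h q₁ + M₂ * h q₂ →
                   sumPt (λ r → w N₁ p₁ N₂ p₂ r * h r) ≡ sumPt (λ r → w M₁ q₁ M₂ q₂ r * h r)
    w-barycentre h eq =
      trans (sumPt-w N₁ p₁ N₂ p₂ h) (trans (cong (d *_) eq) (sym (sumPt-w M₁ q₁ M₂ q₂ h)))

  linear : ℚ → ℚ → Pt a b → ℚ
  linear α β r = α * re r + β * im r

  linear-x : ∀ α β i → linear α β (inj₁ i) ≡ α * xs i
  linear-x α β i = trans (cong (α * xs i +_) (*-zeroʳ β)) (+-identityʳ (α * xs i))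

  linear-y : ∀ α β j → linear α β (inj₂ j) ≡ β * bs j
  linear-y α β j = trans (cong (_+ β * bs j) (*-zeroʳ α)) (+-identityˡ (β * bs j))

  sumPt-linear : ∀ (l : Pt a b → ℚ) α β →
    sumPt (λ r → l r * linear α β r) ≡ α * sumPt (λ r → l r * re r) + β * sumPt (λ r → l r * im r)
  sumPt-linear l α β = begin
    sumPt (λ r → l r * linear α β r)
      ≡⟨ sumPt-cong {a} {b} (λ r → distrib (l r) α (re r) β (im r)) ⟩
    sumPt (λ r → α * (l r * re r) + β * (l r * im r))
      ≡⟨ sumPt-+ (λ r → α * (l r * re r)) (λ r → β * (l r * im r)) ⟩
    sumPt (λ r → α * (l r * re r)) + sumPt (λ r → β * (l r * im r))
      ≡⟨ cong₂ _+_ (sumPt-*ˡ α (λ r → l r * re r)) (sumPt-*ˡ β (λ r → l r * im r)) ⟩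
    α * sumPt (λ r → l r * re r) + β * sumPt (λ r → l r * im r) ∎
    where
    open ≡-Reasoning
    distrib : ∀ l α x β y → l * (α * x + β * y) ≡ α * (l * x) + β * (l * y)
    distrib = solve-∀ ℚ-ring

  separated⇒¬HullsMeet : ∀ (π : Partition (Pt a b)) α β c p q →
    (∀ r → rel π p r ≡ true → c ≤ linear α β r) → (∀ r → rel π q r ≡ true → linear α β r < c) →
    ¬ HullsMeet xs bs π p q
  separated⇒¬HullsMeet π α β c p q c≤φ φ<c (l₁ , l₂ , 0≤l₁ , supp₁ , Σl₁ , 0≤l₂ , supp₂ , Σl₂ , re-eq , im-eq) =
    <-irrefl refl (begin-strict
      c                                 ≤⟨ Average.average-≥ (rel π p) 0≤l₁ supp₁ Σl₁ (linear α β) c≤φ ⟩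
      sumPt (λ r → l₁ r * linear α β r) ≡⟨ sumPt-linear l₁ α β ⟩
      α * sumPt (λ r → l₁ r * re r) + β * sumPt (λ r → l₁ r * im r)
                                        ≡⟨ cong₂ (λ u v → α * u + β * v) re-eq im-eq ⟩
      α * sumPt (λ r → l₂ r * re r) + β * sumPt (λ r → l₂ r * im r)
                                        ≡⟨ sumPt-linear l₂ α β ⟨
      sumPt (λ r → l₂ r * linear α β r) <⟨ Average.average-< (rel π q) 0≤l₂ supp₂ Σl₂ (linear α β) φ<c ⟩
      c                                 ∎)
    where open ≤-Reasoning

  separated⇒¬HullsMeet′ : ∀ (π : Partition (Pt a b)) α β c p q →
    (∀ r → rel π p r ≡ true → c < linear α β r) → (∀ r → rel π q r ≡ true → linear α β r ≤ c) →
    ¬ HullsMeet xs bs π p q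
  separated⇒¬HullsMeet′ π α β c p q c<φ φ≤c meet =
    separated⇒¬HullsMeet π (- α) (- β) (- c) q p
      (λ r qr → subst (- c ≤_) (sym (negate α β r)) (neg-antimono-≤ (φ≤c r qr)))
      (λ r pr → subst (_< - c) (sym (negate α β r)) (neg-antimono-< (c<φ r pr)))
      (HullsMeet-sym π p q meet)
    where
    negate : ∀ α β r → linear (- α) (- β) r ≡ - linear α β r
    negate α β r = neg-linear α (re r) β (im r)
      where
      neg-linear : ∀ α x β y → (- α) * x + (- β) * y ≡ - (α * x + β * y)
      neg-linear = solve-∀ ℚ-ring

  NonCrossing-from-block : ∀ (π : Partition (Pt a b)) p₀ →
    (∀ q → rel π p₀ q ≡ false → ¬ HullsMeet xs bs π p₀ q) →
    (∀ p q → rel π p₀ p ≡ false → rel π p₀ q ≡ false → rel π p q ≡ false → ¬ HullsMeet xs bs π p q) →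
    NonCrossing xs bs π
  NonCrossing-from-block π p₀ block-separated others-separated p q p≁q meet
    with rel π p₀ p ≟ᵇ true | rel π p₀ q ≟ᵇ true
  ... | yes p₀~p | _ = block-separated q (trans (rel-block π p₀ p q p₀~p) p≁q)
                         (HullsMeet-block π p p₀ q (rel-sym π p₀ p p₀~p) meet)
  ... | no _ | yes p₀~q = block-separated p (trans (rel-block π p₀ q p p₀~q) (trans (rel-comm π q p) p≁q))
                            (HullsMeet-block π q p₀ p (rel-sym π p₀ q p₀~q) (HullsMeet-sym π p q meet))
  ... | no p₀≁p | no p₀≁q = others-separated p q (¬-not p₀≁p) (¬-not p₀≁q) p≁q meet

-- What is needed to move convex-combination witnesses between a configuration
-- and the subconfiguration indexed by the image of embed.
record FinEmbedding (n N : ℕ) : Set₁ where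
  field
    embed        : Fin n → Fin N
    Outside      : Fin N → Set
    cover        : ∀ j → Outside j ⊎ ∃ λ i → j ≡ embed i
    ¬outside     : ∀ i → ¬ Outside (embed i)
    push         : (Fin n → ℚ) → Fin N → ℚ
    push-embed   : ∀ g i → push g (embed i) ≡ g i
    push-outside : ∀ g j → Outside j → push g j ≡ 0ℚ
    sumFin-restrict : ∀ f → (∀ j → Outside j → f j ≡ 0ℚ) → sumFin f ≡ sumFin (λ i → f (embed i))
open FinEmbedding

id-embedding : ∀ {n} → FinEmbedding n n
id-embedding = record
  { embed = λ i → i ; Outside = λ _ → ⊥ ; cover = λ j → inj₂ (j , refl) ; ¬outside = λ i ()
  ; push = λ g → g ; push-embed = λ g i → refl ; push-outside = λ g j ()
  ; sumFin-restrict = λ f _ → refl }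

last-or-inject₁ : ∀ {n} (i : Fin (suc n)) → (i ≡ fromℕ n) ⊎ ∃ λ j → i ≡ inject₁ j
last-or-inject₁ {zero}  zero    = inj₁ refl
last-or-inject₁ {suc n} zero    = inj₂ (zero , refl)
last-or-inject₁ {suc n} (suc i) with last-or-inject₁ i
... | inj₁ i≡last     = inj₁ (cong suc i≡last)
... | inj₂ (j , i≡j) = inj₂ (suc j , cong suc i≡j)

inject₁-embedding : ∀ {n} → FinEmbedding n (suc n)
inject₁-embedding {n} = record
  { embed = inject₁ ; Outside = λ j → j ≡ fromℕ n
  ; cover = last-or-inject₁ ; ¬outside = λ i e → Fₚ.fromℕ≢inject₁ (sym e)
  ; push = push₁ ; push-embed = push₁-inject₁
  ; push-outside = λ g j j≡last → trans (cong (push₁ g) j≡last) (push₁-last g)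
  ; sumFin-restrict = λ f f-last → sumFin-drop-last f (f-last (fromℕ n) refl) }
  where
  push₁ : ∀ {n} → (Fin n → ℚ) → Fin (suc n) → ℚ
  push₁ {zero}  g _       = 0ℚ
  push₁ {suc n} g zero    = g zero
  push₁ {suc n} g (suc i) = push₁ (λ j → g (suc j)) i
  push₁-inject₁ : ∀ {n} (g : Fin n → ℚ) i → push₁ g (inject₁ i) ≡ g i
  push₁-inject₁ {suc n} g zero    = refl
  push₁-inject₁ {suc n} g (suc i) = push₁-inject₁ (λ j → g (suc j)) i
  push₁-last : ∀ {n} (g : Fin n → ℚ) → push₁ g (fromℕ n) ≡ 0ℚ
  push₁-last {zero}  g = refl
  push₁-last {suc n} g = push₁-last (λ j → g (suc j))
  sumFin-drop-last : ∀ {n} (f : Fin (suc n) → ℚ) → f (fromℕ n) ≡ 0ℚ →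
                     sumFin f ≡ sumFin (λ i → f (inject₁ i))
  sumFin-drop-last {zero}  f f-last = trans (cong (_+ 0ℚ) f-last) (+-identityˡ 0ℚ)
  sumFin-drop-last {suc n} f f-last = cong (f zero +_) (sumFin-drop-last (λ i → f (suc i)) f-last)

below-or-inject : ∀ {N} (k : Fin N) j → (toℕ k ℕ.≤ toℕ j) ⊎ ∃ λ i → j ≡ inject {i = k} i
below-or-inject zero    j       = inj₁ z≤n
below-or-inject (suc k) zero    = inj₂ (zero , refl)
below-or-inject (suc k) (suc j) with below-or-inject k j
... | inj₁ k≤j         = inj₁ (s≤s k≤j)
... | inj₂ (i , j≡i) = inj₂ (suc i , cong suc j≡i)

≰-inject : ∀ {N} (k : Fin N) i → ¬ (toℕ k ℕ.≤ toℕ (inject {i = k} i))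
≰-inject (suc k) zero    ()
≰-inject (suc k) (suc i) (s≤s k≤i) = ≰-inject k i k≤i

inject-embedding : ∀ {N} (k : Fin N) → FinEmbedding (toℕ k) N
inject-embedding k = record
  { embed = inject ; Outside = λ j → toℕ k ℕ.≤ toℕ j
  ; cover = below-or-inject k ; ¬outside = ≰-inject k
  ; push = push-below k ; push-embed = push-below-inject k ; push-outside = push-below-outside k
  ; sumFin-restrict = sumFin-below k }
  where
  push-below : ∀ {N} (k : Fin N) → (Fin (toℕ k) → ℚ) → Fin N → ℚ
  push-below zero    g _       = 0ℚ
  push-below (suc k) g zero    = g zero
  push-below (suc k) g (suc j) = push-below k (λ i → g (suc i)) j
  push-below-inject : ∀ {N} (k : Fin N) g i → push-below k g (inject i) ≡ g i
  push-below-inject (suc k) g zero    = refl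
  push-below-inject (suc k) g (suc i) = push-below-inject k (λ i → g (suc i)) i
  push-below-outside : ∀ {N} (k : Fin N) g j → toℕ k ℕ.≤ toℕ j → push-below k g j ≡ 0ℚ
  push-below-outside zero    g j       k≤j       = refl
  push-below-outside (suc k) g (suc j) (s≤s k≤j) = push-below-outside k (λ i → g (suc i)) j k≤j
  sumFin-below : ∀ {N} (k : Fin N) (f : Fin N → ℚ) → (∀ j → toℕ k ℕ.≤ toℕ j → f j ≡ 0ℚ) →
                 sumFin f ≡ sumFin (λ i → f (inject {i = k} i))
  sumFin-below {N} zero    f f-high = trans (sumFin-cong (λ j → f-high j z≤n)) (sumFin-zero {N})
  sumFin-below     (suc k) f f-high =
    cong (f zero +_) (sumFin-below k (λ i → f (suc i)) (λ j k≤j → f-high (suc j) (s≤s k≤j)))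

module Restriction {a′ b′ a b : ℕ} (Ex : FinEmbedding a′ a) (Ey : FinEmbedding b′ b)
                   (xs : Fin a → ℚ) (bs : Fin b → ℚ) where

  xs′ : Fin a′ → ℚ
  xs′ i = xs (embed Ex i)
  bs′ : Fin b′ → ℚ
  bs′ j = bs (embed Ey j)

  embedᴾ : Pt a′ b′ → Pt a b
  embedᴾ (inj₁ i) = inj₁ (embed Ex i)
  embedᴾ (inj₂ j) = inj₂ (embed Ey j)

  Outsideᴾ : Pt a b → Set
  Outsideᴾ (inj₁ i) = Outside Ex i
  Outsideᴾ (inj₂ j) = Outside Ey j

  coverᴾ : ∀ r → Outsideᴾ r ⊎ ∃ λ u → r ≡ embedᴾ u
  coverᴾ (inj₁ i) with cover Ex i
  ... | inj₁ out          = inj₁ out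
  ... | inj₂ (i′ , i≡i′) = inj₂ (inj₁ i′ , cong inj₁ i≡i′)
  coverᴾ (inj₂ j) with cover Ey j
  ... | inj₁ out          = inj₁ out
  ... | inj₂ (j′ , j≡j′) = inj₂ (inj₂ j′ , cong inj₂ j≡j′)

  ¬outsideᴾ : ∀ u → ¬ Outsideᴾ (embedᴾ u)
  ¬outsideᴾ (inj₁ i) = ¬outside Ex i
  ¬outsideᴾ (inj₂ j) = ¬outside Ey j

  pushᴾ : (Pt a′ b′ → ℚ) → Pt a b → ℚ
  pushᴾ g (inj₁ i) = push Ex (λ i′ → g (inj₁ i′)) i
  pushᴾ g (inj₂ j) = push Ey (λ j′ → g (inj₂ j′)) j

  pushᴾ-embed : ∀ g u → pushᴾ g (embedᴾ u) ≡ g u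
  pushᴾ-embed g (inj₁ i) = push-embed Ex _ i
  pushᴾ-embed g (inj₂ j) = push-embed Ey _ j

  pushᴾ-outside : ∀ g r → Outsideᴾ r → pushᴾ g r ≡ 0ℚ
  pushᴾ-outside g (inj₁ i) out = push-outside Ex _ i out
  pushᴾ-outside g (inj₂ j) out = push-outside Ey _ j out

  sumPt-restrict : ∀ (f : Pt a b → ℚ) → (∀ r → Outsideᴾ r → f r ≡ 0ℚ) →
                   sumPt f ≡ sumPt (λ u → f (embedᴾ u))
  sumPt-restrict f f-out = cong₂ _+_ (sumFin-restrict Ex _ (λ i out → f-out (inj₁ i) out))
                                     (sumFin-restrict Ey _ (λ j out → f-out (inj₂ j) out))

  pos-embedᴾ : ∀ u → pos xs′ bs′ u ≡ pos xs bs (embedᴾ u)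
  pos-embedᴾ (inj₁ i) = refl
  pos-embedᴾ (inj₂ j) = refl

  sumPt-push : ∀ (l : Pt a′ b′ → ℚ) (h : ℚ × ℚ → ℚ) →
    sumPt (λ r → pushᴾ l r * h (pos xs bs r)) ≡ sumPt (λ u → l u * h (pos xs′ bs′ u))
  sumPt-push l h =
    trans (sumPt-restrict (λ r → pushᴾ l r * h (pos xs bs r))
                          (λ r out → trans (cong (_* _) (pushᴾ-outside l r out)) (*-zeroˡ (h (pos xs bs r)))))
          (sumPt-cong {a′} {b′} (λ u → cong₂ _*_ (pushᴾ-embed l u) (cong h (sym (pos-embedᴾ u)))))

  HullsMeet-push : (π : Partition (Pt a b)) (u v : Pt a′ b′) →
    HullsMeet xs′ bs′ (pullback embedᴾ π) u v → HullsMeet xs bs π (embedᴾ u) (embedᴾ v)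
  HullsMeet-push π u v (l₁ , l₂ , 0≤l₁ , supp₁ , Σl₁ , 0≤l₂ , supp₂ , Σl₂ , re-eq , im-eq) =
    pushᴾ l₁ , pushᴾ l₂ ,
    push-nonNeg l₁ 0≤l₁ , push-supp u l₁ supp₁ , push-total l₁ Σl₁ ,
    push-nonNeg l₂ 0≤l₂ , push-supp v l₂ supp₂ , push-total l₂ Σl₂ ,
    trans (sumPt-push l₁ proj₁) (trans re-eq (sym (sumPt-push l₂ proj₁))) ,
    trans (sumPt-push l₁ proj₂) (trans im-eq (sym (sumPt-push l₂ proj₂)))
    where
    push-nonNeg : ∀ l → (∀ w → 0ℚ ≤ l w) → ∀ r → 0ℚ ≤ pushᴾ l r
    push-nonNeg l 0≤l r with coverᴾ r
    ... | inj₁ out       = ≤-reflexive (sym (pushᴾ-outside l r out))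
    ... | inj₂ (w , refl) = subst (0ℚ ≤_) (sym (pushᴾ-embed l w)) (0≤l w)
    push-supp : ∀ u l → (∀ w → rel π (embedᴾ u) (embedᴾ w) ≡ false → l w ≡ 0ℚ) →
                ∀ r → rel π (embedᴾ u) r ≡ false → pushᴾ l r ≡ 0ℚ
    push-supp u l supp r u≁r with coverᴾ r
    ... | inj₁ out       = pushᴾ-outside l r out
    ... | inj₂ (w , refl) = trans (pushᴾ-embed l w) (supp w u≁r)
    push-total : ∀ l → sumPt l ≡ 1ℚ → sumPt (pushᴾ l) ≡ 1ℚ
    push-total l Σl = trans (sumPt-restrict (pushᴾ l) (pushᴾ-outside l))
                            (trans (sumPt-cong {a′} {b′} (pushᴾ-embed l)) Σl)

  restrict-NonCrossing : (π : Partition (Pt a b)) → NonCrossing xs bs π →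
                         NonCrossing xs′ bs′ (pullback embedᴾ π)
  restrict-NonCrossing π nc u v u≁v meet = nc (embedᴾ u) (embedᴾ v) u≁v (HullsMeet-push π u v meet)

  HullsMeet-pull : (π : Partition (Pt a b)) (u v : Pt a′ b′) →
    (∀ r → rel π (embedᴾ u) r ≡ true → ¬ Outsideᴾ r) → (∀ r → rel π (embedᴾ v) r ≡ true → ¬ Outsideᴾ r) →
    HullsMeet xs bs π (embedᴾ u) (embedᴾ v) → HullsMeet xs′ bs′ (pullback embedᴾ π) u v
  HullsMeet-pull π u v u-inside v-inside (l₁ , l₂ , 0≤l₁ , supp₁ , Σl₁ , 0≤l₂ , supp₂ , Σl₂ , re-eq , im-eq) =
    (λ w → l₁ (embedᴾ w)) , (λ w → l₂ (embedᴾ w)) ,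
    (λ w → 0≤l₁ (embedᴾ w)) , (λ w → supp₁ (embedᴾ w)) , trans (sym (restrict-sum l₁ u-inside supp₁)) Σl₁ ,
    (λ w → 0≤l₂ (embedᴾ w)) , (λ w → supp₂ (embedᴾ w)) , trans (sym (restrict-sum l₂ v-inside supp₂)) Σl₂ ,
    restrict-barycentre proj₁ re-eq , restrict-barycentre proj₂ im-eq
    where
    vanish-outside : ∀ {p} l → (∀ r → rel π p r ≡ true → ¬ Outsideᴾ r) →
                     (∀ r → rel π p r ≡ false → l r ≡ 0ℚ) → ∀ r → Outsideᴾ r → l r ≡ 0ℚ
    vanish-outside {p} l inside supp r out with rel π p r in pr
    ... | true  = ⊥-elim (inside r pr out)
    ... | false = supp r pr
    restrict-sum : ∀ {p} l → (∀ r → rel π p r ≡ true → ¬ Outsideᴾ r) →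
                   (∀ r → rel π p r ≡ false → l r ≡ 0ℚ) → sumPt l ≡ sumPt (λ w → l (embedᴾ w))
    restrict-sum l inside supp = sumPt-restrict l (vanish-outside l inside supp)
    restrict-weighted : ∀ {p} l (h : ℚ × ℚ → ℚ) → (∀ r → rel π p r ≡ true → ¬ Outsideᴾ r) →
      (∀ r → rel π p r ≡ false → l r ≡ 0ℚ) →
      sumPt (λ r → l r * h (pos xs bs r)) ≡ sumPt (λ w → l (embedᴾ w) * h (pos xs′ bs′ w))
    restrict-weighted l h inside supp =
      trans (sumPt-restrict (λ r → l r * h (pos xs bs r))
                            (λ r out → trans (cong (_* _) (vanish-outside l inside supp r out)) (*-zeroˡ (h (pos xs bs r)))))
            (sumPt-cong {a′} {b′} (λ w → cong (λ z → l (embedᴾ w) * h z) (sym (pos-embedᴾ w))))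
    restrict-barycentre : ∀ (h : ℚ × ℚ → ℚ) →
      sumPt (λ r → l₁ r * h (pos xs bs r)) ≡ sumPt (λ r → l₂ r * h (pos xs bs r)) →
      sumPt (λ w → l₁ (embedᴾ w) * h (pos xs′ bs′ w)) ≡ sumPt (λ w → l₂ (embedᴾ w) * h (pos xs′ bs′ w))
    restrict-barycentre h eq =
      trans (sym (restrict-weighted l₁ h u-inside supp₁)) (trans eq (restrict-weighted l₂ h v-inside supp₂))

  inside-blocks-separated : (π : Partition (Pt a b)) (σ : Partition (Pt a′ b′)) →
    (∀ u v → rel π (embedᴾ u) (embedᴾ v) ≡ rel σ u v) → NonCrossing xs′ bs′ σ →
    ∀ u v → rel π (embedᴾ u) (embedᴾ v) ≡ false →
    (∀ r → rel π (embedᴾ u) r ≡ true → ¬ Outsideᴾ r) → (∀ r → rel π (embedᴾ v) r ≡ true → ¬ Outsideᴾ r) →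
    ¬ HullsMeet xs bs π (embedᴾ u) (embedᴾ v)
  inside-blocks-separated π σ π≈σ ncσ u v u≁v u-inside v-inside meet =
    ncσ u v (trans (sym (π≈σ u v)) u≁v)
      (Geometry.HullsMeet-resp xs′ bs′ (pullback embedᴾ π) σ π≈σ (HullsMeet-pull π u v u-inside v-inside meet))

module Configuration {a b : ℕ} (xs : Fin a → ℚ) (bs : Fin b → ℚ)
                     (xs↑ : StrictlyIncreasingPos xs) (bs↑ : StrictlyIncreasingPos bs) where
  open Geometry xs bs public

  x : Fin a → Pt a b
  x = inj₁
  y : Fin b → Pt a b
  y = inj₂

  0<xs : ∀ i → 0ℚ < xs i
  0<xs = proj₁ xs↑
  0<bs : ∀ j → 0ℚ < bs j
  0<bs = proj₁ bs↑
  xs-mono : ∀ {i j} → i F.< j → xs i < xs j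
  xs-mono = proj₂ xs↑ _ _
  bs-mono : ∀ {i j} → i F.< j → bs i < bs j
  bs-mono = proj₂ bs↑ _ _

  private
    split-gap : ∀ u v w → w - u ≡ (w - v) + (v - u)
    split-gap = solve-∀ ℚ-ring
    interpolate : ∀ u v w → (w - v) * u + (v - u) * w ≡ (w - u) * v + 0ℚ * v
    interpolate = solve-∀ ℚ-ring
    on-axis : ∀ u v w → (w - v) * 0ℚ + (v - u) * 0ℚ ≡ (w - u) * 0ℚ + 0ℚ * 0ℚ
    on-axis = solve-∀ ℚ-ring
    cross-total : ∀ u U v V → u * (v - V) + v * (U - u) ≡ U * (v - V) + V * (U - u)
    cross-total = solve-∀ ℚ-ring
    cross-re : ∀ u U v V → U * (v - V) * u + V * (U - u) * 0ℚ ≡ u * (v - V) * U + v * (U - u) * 0ℚ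
    cross-re = solve-∀ ℚ-ring
    cross-im : ∀ u U v V → U * (v - V) * 0ℚ + V * (U - u) * v ≡ u * (v - V) * 0ℚ + v * (U - u) * V
    cross-im = solve-∀ ℚ-ring

  module _ (π : Partition (Pt a b)) (nc : NonCrossing xs bs π) where

    -- x_j = ((x_k - x_j) x_i + (x_j - x_i) x_k) / (x_k - x_i) lies on the segment [x_i, x_k].
    x-between : ∀ {i j k} → i F.< j → j F.< k → rel π (x i) (x k) ≡ true → rel π (x i) (x j) ≡ true
    x-between {i} {j} {k} i<j j<k ik = HullsMeet⇒rel π nc (segments-meet π ik (rel-refl π (x j))
      (xs k - xs j) (xs j - xs i) (xs k - xs i) 0ℚ
      (p<q⇒0≤q-p (xs-mono j<k)) (p<q⇒0≤q-p (xs-mono i<j)) (p<q⇒0≤q-p (xs-mono i<k)) ≤-refl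
      (subst (0ℚ <_) (split-gap (xs i) (xs j) (xs k)) (p<q⇒0<q-p (xs-mono i<k)))
      (trans (+-identityʳ _) (split-gap (xs i) (xs j) (xs k)))
      (interpolate (xs i) (xs j) (xs k)) (on-axis (xs i) (xs j) (xs k)))
      where i<k = ℕₚ.<-trans i<j j<k

    y-between : ∀ {i j k} → i F.< j → j F.< k → rel π (y i) (y k) ≡ true → rel π (y i) (y j) ≡ true
    y-between {i} {j} {k} i<j j<k ik = HullsMeet⇒rel π nc (segments-meet π ik (rel-refl π (y j))
      (bs k - bs j) (bs j - bs i) (bs k - bs i) 0ℚ
      (p<q⇒0≤q-p (bs-mono j<k)) (p<q⇒0≤q-p (bs-mono i<j)) (p<q⇒0≤q-p (bs-mono i<k)) ≤-refl
      (subst (0ℚ <_) (split-gap (bs i) (bs j) (bs k)) (p<q⇒0<q-p (bs-mono i<k)))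
      (trans (+-identityʳ _) (split-gap (bs i) (bs j) (bs k)))
      (on-axis (bs i) (bs j) (bs k)) (interpolate (bs i) (bs j) (bs k)))
      where i<k = ℕₚ.<-trans i<j j<k

    y-interval : ∀ {i j l} → rel π (y i) (y j) ≡ true → toℕ i ℕ.≤ toℕ l → toℕ l ℕ.≤ toℕ j →
                 rel π (y i) (y l) ≡ true
    y-interval {i} {j} {l} ij i≤l l≤j with ℕₚ.m≤n⇒m<n∨m≡n i≤l | ℕₚ.m≤n⇒m<n∨m≡n l≤j
    ... | inj₂ i≡l | _        rewrite Fₚ.toℕ-injective i≡l = rel-refl π (y l)
    ... | inj₁ _   | inj₂ l≡j rewrite Fₚ.toℕ-injective l≡j = ij
    ... | inj₁ i<l | inj₁ l<j = y-between i<l l<j ij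

    -- For i < I and J < j the segments [x_i, y_j] and [x_I, y_J] cross.
    xy-crossing : ∀ {i I J j} → i F.< I → J F.< j → rel π (x i) (y j) ≡ true → rel π (x I) (y J) ≡ true →
                  rel π (x i) (x I) ≡ true
    xy-crossing {i} {I} {J} {j} i<I J<j ij IJ = HullsMeet⇒rel π nc (segments-meet π ij IJ
      (xs I * (bs j - bs J)) (bs J * (xs I - xs i)) (xs i * (bs j - bs J)) (bs j * (xs I - xs i))
      (*-nonNeg (<⇒≤ (0<xs I)) (p<q⇒0≤q-p (bs-mono J<j))) (*-nonNeg (<⇒≤ (0<bs J)) (p<q⇒0≤q-p (xs-mono i<I)))
      (*-nonNeg (<⇒≤ (0<xs i)) (p<q⇒0≤q-p (bs-mono J<j))) (*-nonNeg (<⇒≤ (0<bs j)) (p<q⇒0≤q-p (xs-mono i<I)))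
      (+-mono-<-≤ (*-pos (0<xs I) (p<q⇒0<q-p (bs-mono J<j))) (*-nonNeg (<⇒≤ (0<bs J)) (p<q⇒0≤q-p (xs-mono i<I))))
      (cross-total (xs i) (xs I) (bs j) (bs J)) (cross-re (xs i) (xs I) (bs j) (bs J))
      (cross-im (xs i) (xs I) (bs j) (bs J)))

inject₁-mono-< : ∀ {n} {i j : Fin n} → i F.< j → inject₁ i F.< inject₁ j
inject₁-mono-< {i = i} {j} = subst₂ ℕ._<_ (sym (Fₚ.toℕ-inject₁ i)) (sym (Fₚ.toℕ-inject₁ j))

inject₁<fromℕ : ∀ {n} (i : Fin n) → inject₁ i F.< fromℕ n
inject₁<fromℕ {n} i = subst (toℕ (inject₁ i) ℕ.<_) (sym (Fₚ.toℕ-fromℕ n)) (Fₚ.inject₁ℕ< i)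

≢fromℕ⇒<fromℕ : ∀ {n} (i : Fin (suc n)) → i ≢ fromℕ n → i F.< fromℕ n
≢fromℕ⇒<fromℕ i i≢last with last-or-inject₁ i
... | inj₁ i≡last    = ⊥-elim (i≢last i≡last)
... | inj₂ (j , refl) = inject₁<fromℕ j

inject<k : ∀ {N} {k : Fin N} (i : Fin (toℕ k)) → inject i F.< k
inject<k {k = k} i = subst (ℕ._< toℕ k) (sym (Fₚ.toℕ-inject i)) (Fₚ.toℕ<n i)

first-true : ∀ {n} (f : Fin n → Bool) →
  (∀ j → f j ≡ false) ⊎ Σ (Fin n) λ k → (f k ≡ true) × (∀ j → j F.< k → f j ≡ false)
first-true {zero}  f = inj₁ (λ ())
first-true {suc n} f with f zero in f₀ | first-true (λ j → f (suc j))
... | true  | _ = inj₂ (zero , f₀ , λ j ())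
... | false | inj₁ none = inj₁ λ { zero → f₀ ; (suc j) → none j }
... | false | inj₂ (k , fk , before) =
  inj₂ (suc k , fk , λ { zero _ → f₀ ; (suc j) (s≤s j<k) → before j j<k })

last-true : ∀ {n} (f : Fin n → Bool) →
  (∀ j → f j ≡ false) ⊎ Σ (Fin n) λ k → (f k ≡ true) × (∀ j → k F.< j → f j ≡ false)
last-true {zero}  f = inj₁ (λ ())
last-true {suc n} f with last-true (λ j → f (suc j)) | f zero in f₀
... | inj₂ (k , fk , after) | _ = inj₂ (suc k , fk , λ { zero () ; (suc j) (s≤s k<j) → after j k<j })
... | inj₁ none | true  = inj₂ (zero , f₀ , λ { zero () ; (suc j) _ → none j })
... | inj₁ none | false = inj₁ λ { zero → f₀ ; (suc j) → none j }

order-isomorphism : (P Q : Poset 0ℓ 0ℓ 0ℓ) (f : Poset.Carrier P → Poset.Carrier Q) →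
  (∀ {x y} → Poset._≤_ P x y → Poset._≤_ Q (f x) (f y)) →
  (∀ {x y} → Poset._≤_ Q (f x) (f y) → Poset._≤_ P x y) →
  (g : Poset.Carrier Q → Poset.Carrier P) → (∀ y → Poset._≈_ Q (f (g y)) y) → P ≅ Q
order-isomorphism P Q f mono cancel g f∘g≈id = f , record
  { isOrderMonomorphism = record
    { isOrderHomomorphism = record { cong = f-cong ; mono = mono }
    ; injective = λ e → P.antisym (cancel (Q.reflexive e)) (cancel (Q.reflexive (Q.Eq.sym e)))
    ; cancel = cancel }
  ; surjective = λ y → g y , λ e → Q.Eq.trans (f-cong e) (f∘g≈id y) }
  where
  module P = Poset P
  module Q = Poset Q
  f-cong : ∀ {x y} → x P.≈ y → f x Q.≈ f y
  f-cong e = Q.antisym (mono (P.reflexive e)) (mono (P.reflexive (P.Eq.sym e)))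

singleton-⊆ : ∀ {b b′ : Bool} → (b ≡ true → b′ ≡ true) → (b ∷ []) ⊆ (b′ ∷ [])
singleton-⊆ {true} {true}  _    here = here
singleton-⊆ {true} {false} b⇒b′ here with b⇒b′ refl
... | ()

singleton-⊆⁻ : ∀ {b b′ : Bool} → (b ∷ []) ⊆ (b′ ∷ []) → b ≡ true → b′ ≡ true
singleton-⊆⁻ {true} {true}  _ _ = refl
singleton-⊆⁻ {true} {false} b⊆b′ _ with b⊆b′ here
... | ()

consecutive⇒rel : ∀ {A : Set} {n} (μ : Partition A) (f : Fin (suc n) → A) d {i j} → toℕ j ≡ d ℕ.+ toℕ i →
  (∀ l → toℕ i ℕ.≤ toℕ l → toℕ l ℕ.< toℕ j → rel μ (f (inject₁ l)) (f (suc l)) ≡ true) →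
  rel μ (f i) (f j) ≡ true
consecutive⇒rel μ f zero    {i} {j}      j≡i   _     rewrite Fₚ.toℕ-injective j≡i = rel-refl μ (f i)
consecutive⇒rel μ f (suc d) {i} {suc l} j≡d+i steps =
  rel-trans μ (f i) (f (inject₁ l)) (f (suc l))
    (consecutive⇒rel μ f d (trans (Fₚ.toℕ-inject₁ l) (ℕₚ.suc-injective j≡d+i))
      (λ l′ i≤l′ l′<l → steps l′ i≤l′ (ℕₚ.<-trans (subst (toℕ l′ ℕ.<_) (Fₚ.toℕ-inject₁ l) l′<l) (ℕₚ.n<1+n _))))
    (steps l (subst (toℕ i ℕ.≤_) (ℕₚ.suc-injective (sym j≡d+i)) (ℕₚ.m≤n+m (toℕ i) d)) ℕₚ.≤-refl)

∈-tabulate⁺ : ∀ {n} (f : Fin n → Bool) {g} → f g ≡ true → g ∈ tabulate f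
∈-tabulate⁺ f {g} fg = Vₚ.lookup⇒[]= g (tabulate f) (trans (Vₚ.lookup∘tabulate f g) fg)

∈-tabulate⁻ : ∀ {n} (f : Fin n → Bool) {g} → g ∈ tabulate f → f g ≡ true
∈-tabulate⁻ f {g} g∈ = trans (sym (Vₚ.lookup∘tabulate f g)) (Vₚ.[]=⇒lookup g∈)

-- The number of gaps among the first t that S leaves unjoined; it labels the blocks of a chain.
cuts : ∀ {n} → Subset n → ℕ → ℕ
cuts S           zero    = zero
cuts []          (suc t) = zero
cuts (true ∷ S)  (suc t) = cuts S t
cuts (false ∷ S) (suc t) = suc (cuts S t)

cuts-mono : ∀ {n} (S : Subset n) {u v} → u ℕ.≤ v → cuts S u ℕ.≤ cuts S v
cuts-mono S           {zero}              _         = z≤n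
cuts-mono []          {suc u} {suc v}     _         = z≤n
cuts-mono (true ∷ S)  {suc u} {suc v} (s≤s u≤v) = cuts-mono S u≤v
cuts-mono (false ∷ S) {suc u} {suc v} (s≤s u≤v) = s≤s (cuts-mono S u≤v)

cuts-gap : ∀ {n} (S : Subset n) g → (cuts S (toℕ g) ℕ.≡ᵇ cuts S (suc (toℕ g))) ≡ lookup S g
cuts-gap (true ∷ S)  zero    = refl
cuts-gap (false ∷ S) zero    = refl
cuts-gap (true ∷ S)  (suc g) = cuts-gap S g
cuts-gap (false ∷ S) (suc g) = cuts-gap S g

module Setting (m′ n′ : ℕ) (xs : Fin (suc (suc m′)) → ℚ) (bs : Fin (suc n′) → ℚ)
               (xs↑ : StrictlyIncreasingPos xs) (bs↑ : StrictlyIncreasingPos bs) where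
  open Configuration xs bs xs↑ bs↑ public

  U : Set
  U = Pt (suc (suc m′)) (suc n′)

  x-last x-prev : U
  x-last = xLast {m′} {n′}
  x-prev = xPrev {m′} {n′}

  prev<last : inject₁ (fromℕ m′) F.< fromℕ (suc m′)
  prev<last = inject₁<fromℕ (fromℕ m′)

  module _ (π : Partition U) (nc : NonCrossing xs bs π) where

    -- x_{m-1} lies between x_i and x_m
    joins-prev : ∀ i → rel π x-last (x (inject₁ i)) ≡ true → rel π x-last x-prev ≡ true
    joins-prev i last~i with last-or-inject₁ i
    ... | inj₁ refl       = last~i
    ... | inj₂ (j , refl) = rel-trans π x-last (x (inject₁ (inject₁ j))) x-prev last~i
      (x-between π nc (inject₁-mono-< (inject₁<fromℕ j)) prev<last (rel-sym π x-last _ last~i))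

    InA⊎InB : InA π ⊎ ∃ (λ k → InB k π)
    InA⊎InB with rel π x-last x-prev ≟ᵇ true
    ... | yes last~prev = inj₁ (inj₂ last~prev)
    ... | no last≁prev with first-true (λ j → rel π x-last (y j))
    ...   | inj₂ (k , last~k , before) = inj₂ (k , last~k , ¬-not last≁prev , before)
    ...   | inj₁ none = inj₁ (inj₁ singleton)
      where
      singleton : ∀ p → rel π x-last p ≡ true → p ≡ x-last
      singleton (inj₂ j) last~j = ⊥-elim (not-¬ last~j (none j))
      singleton (inj₁ i) last~i with last-or-inject₁ i
      ... | inj₁ refl       = refl
      ... | inj₂ (j , refl) = ⊥-elim (last≁prev (joins-prev j last~i))

  ¬InA×InB : ∀ (π : Partition U) k → InA π → InB k π → ⊥
  ¬InA×InB π k (inj₁ singleton) (last~k , _) with singleton (y k) last~k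
  ... | ()
  ¬InA×InB π k (inj₂ last~prev) (_ , last≁prev , _) = not-¬ last~prev last≁prev

  InB-unique : ∀ (π : Partition U) k l → InB k π → InB l π → k ≡ l
  InB-unique π k l (last~k , _ , before-k) (last~l , _ , before-l) with Fₚ.<-cmp k l
  ... | tri< k<l _ _ = ⊥-elim (not-¬ last~k (before-l k k<l))
  ... | tri≈ _ k≡l _ = k≡l
  ... | tri> _ _ l<k = ⊥-elim (not-¬ last~l (before-k l l<k))

-- The piece A

-- X is the position of a new point beyond x_m that is to join the block of x_m.
module PrevBlockSeparation {m b : ℕ} (xs : Fin (suc m) → ℚ) (bs : Fin b → ℚ)
    (xs↑ : StrictlyIncreasingPos xs) (bs↑ : StrictlyIncreasingPos bs)
    (X : ℚ) (xs<X : ∀ i → xs i < X)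
    (σ : Partition (Pt (suc m) b)) (nc : NonCrossing xs bs σ) where
  open Configuration xs bs xs↑ bs↑

  p : Pt (suc m) b
  p = x (fromℕ m)

  Above Below : Pt (suc m) b → ℚ → ℚ → ℚ → Set
  Above q α β c = (c ≤ α * X) × (∀ w → rel σ p w ≡ true → c ≤ linear α β w)
                  × (∀ w → rel σ q w ≡ true → linear α β w < c)
  Below q α β c = (α * X ≤ c) × (∀ w → rel σ p w ≡ true → linear α β w ≤ c)
                  × (∀ w → rel σ q w ≡ true → c < linear α β w)

  Separation : Pt (suc m) b → Set
  Separation q = Σ ℚ λ α → Σ ℚ λ β → Σ ℚ λ c → Above q α β c ⊎ Below q α β c

  module _ {q} (p≁q : rel σ p q ≡ false) where

    ≁p : ∀ {w} → rel σ q w ≡ true → rel σ p w ≡ false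
    ≁p q~w = ¬-not (λ p~w → not-¬ (rel-trans σ p _ q p~w (rel-sym σ q _ q~w)) p≁q)

    x-left : ∀ {a i} → rel σ p (x a) ≡ true → rel σ q (x i) ≡ true → i F.< a
    x-left {a} {i} p~a q~i with Fₚ.<-cmp i a
    ... | tri< i<a _ _ = i<a
    ... | tri≈ _ refl _ = ⊥-elim (not-¬ p~a (≁p q~i))
    ... | tri> _ _ a<i = ⊥-elim (not-¬ (rel-trans σ p (x a) (x i) p~a a~i) (≁p q~i))
      where
      i<last : i F.< fromℕ m
      i<last = ≢fromℕ⇒<fromℕ i (λ { refl → not-¬ (rel-refl σ p) (≁p q~i) })
      a~i : rel σ (x a) (x i) ≡ true
      a~i = x-between σ nc a<i i<last (rel-sym σ p (x a) p~a)

    y-outside : ∀ {s t j} → rel σ p (y s) ≡ true → rel σ p (y t) ≡ true → rel σ q (y j) ≡ true →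
                j F.< s ⊎ t F.< j
    y-outside {s} {t} {j} p~s p~t q~j with Fₚ.<-cmp j s | Fₚ.<-cmp j t
    ... | tri< j<s _ _ | _             = inj₁ j<s
    ... | tri≈ _ refl _ | _            = ⊥-elim (not-¬ p~s (≁p q~j))
    ... | tri> _ _ _    | tri≈ _ refl _ = ⊥-elim (not-¬ p~t (≁p q~j))
    ... | tri> _ _ _    | tri> _ _ t<j  = inj₂ t<j
    ... | tri> _ _ s<j  | tri< j<t _ _  = ⊥-elim (not-¬ (rel-trans σ p (y s) (y j) p~s s~j) (≁p q~j))
      where
      s~j : rel σ (y s) (y j) ≡ true
      s~j = y-between σ nc s<j j<t (rel-trans σ (y s) p (y t) (rel-sym σ p (y s) p~s) p~t)

    separation-no-y : ∀ {a} → rel σ p (x a) ≡ true → (∀ i → i F.< a → rel σ p (x i) ≡ false) →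
                      (∀ j → rel σ p (y j) ≡ false) → Separation q
    separation-no-y {a} p~a a-first no-y = 1ℚ , 0ℚ , xs a , inj₁ (at-X , on-p , on-q)
      where
      at-X : xs a ≤ 1ℚ * X
      at-X = subst (xs a ≤_) (sym (*-identityˡ X)) (<⇒≤ (xs<X a))
      on-p : ∀ w → rel σ p w ≡ true → xs a ≤ linear 1ℚ 0ℚ w
      on-p (inj₁ i) p~i = subst (xs a ≤_) (sym (trans (linear-x 1ℚ 0ℚ i) (*-identityˡ (xs i))))
                                (strictly-increasing⇒≤ xs xs-mono (λ i<a → not-¬ p~i (a-first i i<a)))
      on-p (inj₂ j) p~j = ⊥-elim (not-¬ p~j (no-y j))
      on-q : ∀ w → rel σ q w ≡ true → linear 1ℚ 0ℚ w < xs a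
      on-q (inj₁ i) q~i = subst (_< xs a) (sym (trans (linear-x 1ℚ 0ℚ i) (*-identityˡ (xs i))))
                                (xs-mono (x-left p~a q~i))
      on-q (inj₂ j) q~j = subst (_< xs a) (sym (trans (linear-y 1ℚ 0ℚ j) (*-zeroˡ (bs j)))) (0<xs a)

    -- the line through x_a and y_s, the first points of the block of p on either axis
    separation-below : ∀ {a s t} → rel σ p (x a) ≡ true → (∀ i → i F.< a → rel σ p (x i) ≡ false) →
      rel σ p (y s) ≡ true → (∀ j → j F.< s → rel σ p (y j) ≡ false) → rel σ p (y t) ≡ true →
      (∀ j → rel σ q (y j) ≡ true → ¬ (t F.< j)) → Separation q
    separation-below {a} {s} {t} p~a a-first p~s s-first p~t q-below-t =
      bs s , xs a , xs a * bs s , inj₁ (at-X , on-p , on-q)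
      where
      at-X : xs a * bs s ≤ bs s * X
      at-X = subst (_≤ bs s * X) (*-comm (bs s) (xs a)) (*-monoʳ-≤-0≤ (<⇒≤ (0<bs s)) (<⇒≤ (xs<X a)))
      on-p : ∀ w → rel σ p w ≡ true → xs a * bs s ≤ linear (bs s) (xs a) w
      on-p (inj₁ i) p~i = subst₂ _≤_ (*-comm (bs s) (xs a)) (sym (linear-x (bs s) (xs a) i))
        (*-monoʳ-≤-0≤ (<⇒≤ (0<bs s)) (strictly-increasing⇒≤ xs xs-mono (λ i<a → not-¬ p~i (a-first i i<a))))
      on-p (inj₂ j) p~j = subst (xs a * bs s ≤_) (sym (linear-y (bs s) (xs a) j))
        (*-monoʳ-≤-0≤ (<⇒≤ (0<xs a)) (strictly-increasing⇒≤ bs bs-mono (λ j<s → not-¬ p~j (s-first j j<s))))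
      on-q : ∀ w → rel σ q w ≡ true → linear (bs s) (xs a) w < xs a * bs s
      on-q (inj₁ i) q~i = subst₂ _<_ (sym (linear-x (bs s) (xs a) i)) (*-comm (bs s) (xs a))
        (*-monoʳ-<-0< (0<bs s) (xs-mono (x-left p~a q~i)))
      on-q (inj₂ j) q~j with y-outside p~s p~t q~j
      ... | inj₁ j<s = subst (_< xs a * bs s) (sym (linear-y (bs s) (xs a) j)) (*-monoʳ-<-0< (0<xs a) (bs-mono j<s))
      ... | inj₂ t<j = ⊥-elim (q-below-t j q~j t<j)

    -- the line through x_m and y_t, where y_t is the highest point of the block of p
    separation-above : ∀ {t c} → rel σ p (y t) ≡ true → (∀ j → t F.< j → rel σ p (y j) ≡ false) →
                       rel σ q (y c) ≡ true → t F.< c → Separation q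
    separation-above {t} {c} p~t t-last q~c t<c = bs t , X , X * bs t , inj₂ (at-X , on-p , on-q)
      where
      0<X : 0ℚ < X
      0<X = <-trans (0<xs (fromℕ m)) (xs<X (fromℕ m))
      at-X : bs t * X ≤ X * bs t
      at-X = ≤-reflexive (*-comm (bs t) X)
      on-p : ∀ w → rel σ p w ≡ true → linear (bs t) X w ≤ X * bs t
      on-p (inj₁ i) _ = subst₂ _≤_ (sym (linear-x (bs t) X i)) (*-comm (bs t) X)
        (*-monoʳ-≤-0≤ (<⇒≤ (0<bs t)) (<⇒≤ (xs<X i)))
      on-p (inj₂ j) p~j = subst (_≤ X * bs t) (sym (linear-y (bs t) X j))
        (*-monoʳ-≤-0≤ (<⇒≤ 0<X) (strictly-increasing⇒≤ bs bs-mono (λ t<j → not-¬ p~j (t-last j t<j))))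
      on-q : ∀ w → rel σ q w ≡ true → X * bs t < linear (bs t) X w
      on-q (inj₁ i) q~i = ⊥-elim (not-¬ (rel-sym σ (x i) p i~p) (≁p q~i))
        where
        i<last : i F.< fromℕ m
        i<last = ≢fromℕ⇒<fromℕ i (λ { refl → not-¬ (rel-refl σ p) (≁p q~i) })
        i~p : rel σ (x i) p ≡ true
        i~p = xy-crossing σ nc i<last t<c (rel-trans σ (x i) q (y c) (rel-sym σ q (x i) q~i) q~c) p~t
      on-q (inj₂ j) q~j with Fₚ.<-cmp j t
      ... | tri< j<t _ _ = ⊥-elim (not-¬ (rel-trans σ p (y t) (y j) p~t (rel-sym σ (y j) (y t) j~t)) (≁p q~j))
        where
        j~t : rel σ (y j) (y t) ≡ true
        j~t = y-between σ nc j<t t<c (rel-trans σ (y j) q (y c) (rel-sym σ q (y j) q~j) q~c)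
      ... | tri≈ _ refl _ = ⊥-elim (not-¬ p~t (≁p q~j))
      ... | tri> _ _ t<j = subst (X * bs t <_) (sym (linear-y (bs t) X j)) (*-monoʳ-<-0< 0<X (bs-mono t<j))

    separation : Separation q
    separation with first-true (λ i → rel σ p (x i))
    ... | inj₁ no-x = ⊥-elim (not-¬ (rel-refl σ p) (no-x (fromℕ m)))
    ... | inj₂ (a , p~a , a-first) with first-true (λ j → rel σ p (y j)) | last-true (λ j → rel σ p (y j))
    ...   | inj₁ no-y | _ = separation-no-y p~a a-first no-y
    ...   | inj₂ (s , p~s , _) | inj₁ no-y = ⊥-elim (not-¬ p~s (no-y s))
    ...   | inj₂ (s , p~s , s-first) | inj₂ (t , p~t , t-last) with last-true (λ j → rel σ q (y j))
    ...     | inj₁ q-no-y = separation-below p~a a-first p~s s-first p~t (λ j q~j _ → not-¬ q~j (q-no-y j))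
    ...     | inj₂ (c , q~c , c-last) with toℕ t ℕ.<? toℕ c
    ...       | yes t<c = separation-above p~t t-last q~c t<c
    ...       | no t≮c = separation-below p~a a-first p~s s-first p~t
                  (λ j q~j t<j → t≮c (ℕₚ.<-≤-trans t<j (ℕₚ.≮⇒≥ (λ c<j → not-¬ q~j (c-last j c<j)))))

module PieceA (m′ n′ : ℕ) (xs : Fin (suc (suc m′)) → ℚ) (bs : Fin (suc n′) → ℚ)
              (xs↑ : StrictlyIncreasingPos xs) (bs↑ : StrictlyIncreasingPos bs) where
  open Setting m′ n′ xs bs xs↑ bs↑
  open Restriction (inject₁-embedding {suc m′}) (id-embedding {suc n′}) xs bs

  U⁻ : Set
  U⁻ = Pt (suc m′) (suc n′)

  xs′↑ : StrictlyIncreasingPos xs′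
  xs′↑ = (λ i → 0<xs (inject₁ i)) , (λ i j i<j → xs-mono (inject₁-mono-< i<j))

  X : ℚ
  X = xs (fromℕ (suc m′))

  xs′<X : ∀ i → xs′ i < X
  xs′<X i = xs-mono (inject₁<fromℕ i)

  prev⁻ : U⁻
  prev⁻ = inj₁ (fromℕ m′)

  outside⇒last : ∀ r → Outsideᴾ r → r ≡ x-last
  outside⇒last (inj₁ i) i≡last = cong inj₁ i≡last

  -- x_m is sent to the block of x_{m-1} or to a fresh block
  image-of-last : Bool → U⁻ ⊎ ℕ
  image-of-last true  = inj₁ prev⁻
  image-of-last false = inj₂ 0

  collapse : Bool → U → U⁻ ⊎ ℕ
  collapse joined (inj₂ j) = inj₁ (inj₂ j)
  collapse joined (inj₁ i) with last-or-inject₁ i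
  ... | inj₁ _       = image-of-last joined
  ... | inj₂ (j , _) = inj₁ (inj₁ j)

  collapse-embed : ∀ joined u → collapse joined (embedᴾ u) ≡ inj₁ u
  collapse-embed joined (inj₂ j) = refl
  collapse-embed joined (inj₁ i) with last-or-inject₁ (inject₁ i)
  ... | inj₁ e       = ⊥-elim (Fₚ.fromℕ≢inject₁ (sym e))
  ... | inj₂ (j , e) = cong (λ z → inj₁ (inj₁ z)) (sym (Fₚ.inject₁-injective e))

  collapse-last : ∀ joined → collapse joined x-last ≡ image-of-last joined
  collapse-last joined with last-or-inject₁ (fromℕ (suc m′))
  ... | inj₁ _       = refl
  ... | inj₂ (j , e) = ⊥-elim (Fₚ.fromℕ≢inject₁ e)

  extend : Bool → Partition U⁻ → Partition U
  extend joined σ = pullback (collapse joined) (σ ⊎ᴾ discreteℕ)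

  module _ (joined : Bool) (σ : Partition U⁻) where

    private
      ρ : Partition U
      ρ = extend joined σ

    rel-extend-embed : ∀ u v → rel (extend joined σ) (embedᴾ u) (embedᴾ v) ≡ rel σ u v
    rel-extend-embed u v = cong₂ (relᵘ σ discreteℕ) (collapse-embed joined u) (collapse-embed joined v)

    rel-extend-last : ∀ v → rel (extend joined σ) x-last (embedᴾ v)
                          ≡ relᵘ σ discreteℕ (image-of-last joined) (inj₁ v)
    rel-extend-last v = cong₂ (relᵘ σ discreteℕ) (collapse-last joined) (collapse-embed joined v)

    -- blocks not containing x_m are blocks of σ
    blocks-off-last-separated : NonCrossing xs′ bs σ → ∀ p₀ → rel (extend joined σ) p₀ x-last ≡ true →
      ∀ p q → rel (extend joined σ) p₀ p ≡ false → rel (extend joined σ) p₀ q ≡ false →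
      rel (extend joined σ) p q ≡ false → ¬ HullsMeet xs bs (extend joined σ) p q
    blocks-off-last-separated ncσ p₀ p₀~last p q p₀≁p p₀≁q p≁q with coverᴾ p | coverᴾ q
    ... | inj₁ out | _ = ⊥-elim (not-¬ (subst (λ z → rel ρ p₀ z ≡ true) (sym (outside⇒last p out)) p₀~last) p₀≁p)
    ... | inj₂ _ | inj₁ out = ⊥-elim (not-¬ (subst (λ z → rel ρ p₀ z ≡ true) (sym (outside⇒last q out)) p₀~last) p₀≁q)
    ... | inj₂ (u , refl) | inj₂ (v , refl) =
      inside-blocks-separated ρ σ rel-extend-embed ncσ u v p≁q (inside u p₀≁p) (inside v p₀≁q)
      where
      inside : ∀ u → rel ρ p₀ (embedᴾ u) ≡ false → ∀ r → rel ρ (embedᴾ u) r ≡ true → ¬ Outsideᴾ r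
      inside u p₀≁u r u~r out = not-¬ (rel-trans ρ p₀ x-last (embedᴾ u) p₀~last
        (rel-sym ρ (embedᴾ u) x-last (subst (λ z → rel ρ (embedᴾ u) z ≡ true) (outside⇒last r out) u~r))) p₀≁u

  rel-extend-last-prev : ∀ joined σ → rel (extend joined σ) x-last x-prev ≡ joined
  rel-extend-last-prev true  σ = trans (rel-extend-last true σ prev⁻) (rel-refl σ prev⁻)
  rel-extend-last-prev false σ = rel-extend-last false σ prev⁻

  extend-InA : ∀ joined σ → InA (extend joined σ)
  extend-InA true  σ = inj₂ (rel-extend-last-prev true σ)
  extend-InA false σ = inj₁ singleton
    where
    singleton : ∀ p → rel (extend false σ) x-last p ≡ true → p ≡ x-last
    singleton p last~p with coverᴾ p
    ... | inj₁ out        = outside⇒last p out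
    ... | inj₂ (v , refl) = ⊥-elim (not-¬ last~p (rel-extend-last false σ v))

  -- the vertical line through x_m
  last-separated : ∀ σ q → rel (extend false σ) x-last q ≡ false → ¬ HullsMeet xs bs (extend false σ) x-last q
  last-separated σ q last≁q = separated⇒¬HullsMeet (extend false σ) 1ℚ 0ℚ X x-last q on-last on-q
    where
    on-last : ∀ r → rel (extend false σ) x-last r ≡ true → X ≤ linear 1ℚ 0ℚ r
    on-last r last~r with coverᴾ r
    ... | inj₁ out rewrite outside⇒last r out =
      ≤-reflexive (sym (trans (linear-x 1ℚ 0ℚ (fromℕ (suc m′))) (*-identityˡ X)))
    ... | inj₂ (v , refl) = ⊥-elim (not-¬ last~r (rel-extend-last false σ v))
    on-q : ∀ r → rel (extend false σ) q r ≡ true → linear 1ℚ 0ℚ r < X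
    on-q r q~r with coverᴾ r
    ... | inj₁ out = ⊥-elim (not-¬ (rel-sym (extend false σ) q x-last
                       (subst (λ z → rel (extend false σ) q z ≡ true) (outside⇒last r out) q~r)) last≁q)
    on-q r q~r | inj₂ (inj₁ i , refl) = subst (_< X) (sym (trans (linear-x 1ℚ 0ℚ _) (*-identityˡ _))) (xs′<X i)
    on-q r q~r | inj₂ (inj₂ j , refl) = subst (_< X) (sym (trans (linear-y 1ℚ 0ℚ j) (*-zeroˡ (bs j))))
                                              (0<xs (fromℕ (suc m′)))

  prev~last : ∀ σ → rel (extend true σ) x-prev x-last ≡ true
  prev~last σ = rel-sym (extend true σ) x-last x-prev (rel-extend-last-prev true σ)

  linear⁻ : ℚ → ℚ → U⁻ → ℚ
  linear⁻ = Geometry.linear xs′ bs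

  linear-embed : ∀ α β w → linear α β (embedᴾ w) ≡ linear⁻ α β w
  linear-embed α β w = cong (λ z → α * proj₁ z + β * proj₂ z) (sym (pos-embedᴾ w))

  module _ (σ : Partition U⁻) (ncσ : NonCrossing xs′ bs σ) where

    private
      ρ : Partition U
      ρ = extend true σ

    on-prev-block : (P : ℚ → Set) → ∀ α β → P (α * X) → (∀ w → rel σ prev⁻ w ≡ true → P (linear⁻ α β w)) →
                    ∀ r → rel ρ x-prev r ≡ true → P (linear α β r)
    on-prev-block P α β at-X on-prev r prev~r with coverᴾ r
    ... | inj₁ out rewrite outside⇒last r out = subst P (sym (linear-x α β (fromℕ (suc m′)))) at-X
    ... | inj₂ (w , refl) =
      subst P (sym (linear-embed α β w)) (on-prev w (trans (sym (rel-extend-embed true σ prev⁻ w)) prev~r))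

    on-lower-block : (P : ℚ → Set) → ∀ α β q → rel ρ x-prev (embedᴾ q) ≡ false →
                     (∀ w → rel σ q w ≡ true → P (linear⁻ α β w)) →
                     ∀ r → rel ρ (embedᴾ q) r ≡ true → P (linear α β r)
    on-lower-block P α β q prev≁q on-q r q~r with coverᴾ r
    ... | inj₁ out = ⊥-elim (not-¬ (rel-trans ρ x-prev x-last (embedᴾ q) (prev~last σ)
          (rel-sym ρ (embedᴾ q) x-last (subst (λ z → rel ρ (embedᴾ q) z ≡ true) (outside⇒last r out) q~r))) prev≁q)
    ... | inj₂ (w , refl) =
      subst P (sym (linear-embed α β w)) (on-q w (trans (sym (rel-extend-embed true σ q w)) q~r))

    prev-block-separated : ∀ q → rel ρ x-prev q ≡ false → ¬ HullsMeet xs bs ρ x-prev q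
    prev-block-separated q prev≁q with coverᴾ q
    ... | inj₁ out = ⊥-elim (not-¬ (subst (λ z → rel ρ x-prev z ≡ true) (sym (outside⇒last q out)) (prev~last σ)) prev≁q)
    ... | inj₂ (q′ , refl)
      with PrevBlockSeparation.separation xs′ bs xs′↑ bs↑ X xs′<X σ ncσ
             (trans (sym (rel-extend-embed true σ prev⁻ q′)) prev≁q)
    ...   | α , β , c , inj₁ (at-X , on-prev , on-q) =
      separated⇒¬HullsMeet ρ α β c x-prev (embedᴾ q′)
        (on-prev-block (c ≤_) α β at-X on-prev) (on-lower-block (_< c) α β q′ prev≁q on-q)
    ...   | α , β , c , inj₂ (at-X , on-prev , on-q) = λ meet →
      separated⇒¬HullsMeet′ ρ α β c (embedᴾ q′) x-prev
        (on-lower-block (c <_) α β q′ prev≁q on-q) (on-prev-block (_≤ c) α β at-X on-prev)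
        (HullsMeet-sym ρ x-prev (embedᴾ q′) meet)

  extend-NonCrossing : ∀ joined σ → NonCrossing xs′ bs σ → NonCrossing xs bs (extend joined σ)
  extend-NonCrossing false σ ncσ = NonCrossing-from-block (extend false σ) x-last (last-separated σ)
    (blocks-off-last-separated false σ ncσ x-last (rel-refl (extend false σ) x-last))
  extend-NonCrossing true σ ncσ = NonCrossing-from-block (extend true σ) x-prev (prev-block-separated σ ncσ)
    (blocks-off-last-separated true σ ncσ x-prev (prev~last σ))

  PieceA : Poset 0ℓ 0ℓ 0ℓ
  PieceA = SubPoset (NC xs bs) (λ π → InA (proj₁ π))

  Model : Poset 0ℓ 0ℓ 0ℓ
  Model = NC xs′ bs ×ᴾ BoolPoset 1

  restrictA : Poset.Carrier PieceA → Poset.Carrier Model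
  restrictA ((π , nc) , _) = (pullback embedᴾ π , restrict-NonCrossing π nc) , (rel π x-last x-prev ∷ [])

  extendA : Poset.Carrier Model → Poset.Carrier PieceA
  extendA ((σ , ncσ) , (joined ∷ [])) = (extend joined σ , extend-NonCrossing joined σ ncσ) , extend-InA joined σ

  restrictA∘extendA : ∀ τ → Poset._≈_ Model (restrictA (extendA τ)) τ
  restrictA∘extendA ((σ , _) , (joined ∷ [])) =
    rel-extend-embed joined σ , cong (_∷ []) (rel-extend-last-prev joined σ)

  restrictA-mono : ∀ {π μ} → Poset._≤_ PieceA π μ →
                   Poset._≤_ Model (restrictA π) (restrictA μ)
  restrictA-mono π≤μ = (λ u v → π≤μ (embedᴾ u) (embedᴾ v)) , singleton-⊆ (π≤μ x-last x-prev)

  InA-last⇒prev : ∀ {π} → InA π → ∀ v → rel π x-last (embedᴾ v) ≡ true → rel π x-last x-prev ≡ true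
  InA-last⇒prev (inj₁ singleton) v last~v =
    ⊥-elim (¬outsideᴾ v (subst Outsideᴾ (sym (singleton (embedᴾ v) last~v)) refl))
  InA-last⇒prev (inj₂ last~prev) v _      = last~prev

  restrictA-cancel : ∀ {π μ} → Poset._≤_ Model (restrictA π) (restrictA μ) →
                     Poset._≤_ PieceA π μ
  restrictA-cancel {(π , _) , π∈A} {(μ , _) , _} (π≤μ⁻ , last-prev⊆) = π≤μ
    where
    last-to-lower : ∀ v → rel π x-last (embedᴾ v) ≡ true → rel μ x-last (embedᴾ v) ≡ true
    last-to-lower v last~v = rel-trans μ x-last x-prev (embedᴾ v)
      (singleton-⊆⁻ last-prev⊆ (InA-last⇒prev {π} π∈A v last~v))
      (π≤μ⁻ prev⁻ v (rel-trans π x-prev x-last (embedᴾ v)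
        (rel-sym π x-last x-prev (InA-last⇒prev {π} π∈A v last~v)) last~v))
    π≤μ : ∀ p q → rel π p q ≡ true → rel μ p q ≡ true
    π≤μ p q p~q with coverᴾ p | coverᴾ q
    ... | inj₁ out | inj₁ out′ rewrite outside⇒last p out | outside⇒last q out′ = rel-refl μ x-last
    ... | inj₁ out | inj₂ (v , refl) rewrite outside⇒last p out = last-to-lower v p~q
    ... | inj₂ (u , refl) | inj₁ out rewrite outside⇒last q out =
      rel-sym μ x-last (embedᴾ u) (last-to-lower u (rel-sym π (embedᴾ u) x-last p~q))
    ... | inj₂ (u , refl) | inj₂ (v , refl) = π≤μ⁻ u v p~q

  PieceA≅ : PieceA ≅ Model
  PieceA≅ = order-isomorphism PieceA Model restrictA
              (λ {π} {μ} → restrictA-mono {π} {μ}) (λ {π} {μ} → restrictA-cancel {π} {μ})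
              extendA restrictA∘extendA

-- The pieces B_k

module PieceB (m′ n′ : ℕ) (xs : Fin (suc (suc m′)) → ℚ) (bs : Fin (suc n′) → ℚ)
              (xs↑ : StrictlyIncreasingPos xs) (bs↑ : StrictlyIncreasingPos bs) (k : Fin (suc n′)) where
  open Setting m′ n′ xs bs xs↑ bs↑
  open Restriction (inject₁-embedding {suc m′}) (inject-embedding k) xs bs

  K G : ℕ
  K = toℕ k
  G = n′ ∸ K

  U⁻ : Set
  U⁻ = Pt (suc m′) K

  K≤n′ : K ℕ.≤ n′
  K≤n′ = ℕₚ.≤-pred (Fₚ.toℕ<n k)

  -- gap g lies between y_{k+g} = y (inject₁ (gap g)) and y_{k+g+1} = y (suc (gap g))
  gap : Fin G → Fin n′
  gap g = fromℕ< (subst (K ℕ.+ toℕ g ℕ.<_) (ℕₚ.m+[n∸m]≡n K≤n′) (ℕₚ.+-monoʳ-< K (Fₚ.toℕ<n g)))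

  toℕ-gap : ∀ g → toℕ (gap g) ≡ K ℕ.+ toℕ g
  toℕ-gap g = Fₚ.toℕ-fromℕ< _

  gap-of : (l : Fin n′) → K ℕ.≤ toℕ l → Fin G
  gap-of l K≤l = fromℕ< (ℕₚ.∸-monoˡ-< (Fₚ.toℕ<n l) K≤l)

  gap-gap-of : ∀ l K≤l → gap (gap-of l K≤l) ≡ l
  gap-gap-of l K≤l = Fₚ.toℕ-injective (begin
    toℕ (gap (gap-of l K≤l))           ≡⟨ toℕ-gap (gap-of l K≤l) ⟩
    K ℕ.+ toℕ (gap-of l K≤l)           ≡⟨ cong (K ℕ.+_) (Fₚ.toℕ-fromℕ< _) ⟩
    K ℕ.+ (toℕ l ∸ K)                  ≡⟨ ℕₚ.m+[n∸m]≡n K≤l ⟩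
    toℕ l                              ∎)
    where open ≡-Reasoning

  joined-gaps : Partition U → Subset G
  joined-gaps π = tabulate (λ g → rel π (y (inject₁ (gap g))) (y (suc (gap g))))

  -- the position of an upper point (x_m or y_j with j ≥ k) in the chain x_m, y_k, …, y_n
  position : U → ℕ
  position (inj₁ _) = 0
  position (inj₂ j) = toℕ j ∸ K

  label : Subset G → U → ℕ
  label S r = cuts S (position r)

  collapse : Subset G → U → U⁻ ⊎ ℕ
  collapse S (inj₁ i) with last-or-inject₁ i
  ... | inj₁ _       = inj₂ (cuts S 0)
  ... | inj₂ (i′ , _) = inj₁ (inj₁ i′)
  collapse S (inj₂ j) with below-or-inject k j
  ... | inj₁ _       = inj₂ (cuts S (toℕ j ∸ K))
  ... | inj₂ (j′ , _) = inj₁ (inj₂ j′)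

  collapse-embed : ∀ S u → collapse S (embedᴾ u) ≡ inj₁ u
  collapse-embed S (inj₁ i) with last-or-inject₁ (inject₁ i)
  ... | inj₁ e       = ⊥-elim (Fₚ.fromℕ≢inject₁ (sym e))
  ... | inj₂ (i′ , e) = cong (λ z → inj₁ (inj₁ z)) (sym (Fₚ.inject₁-injective e))
  collapse-embed S (inj₂ j) with below-or-inject k (inject j)
  ... | inj₁ k≤j     = ⊥-elim (≰-inject k j k≤j)
  ... | inj₂ (j′ , e) = cong (λ z → inj₁ (inj₂ z))
    (sym (Fₚ.toℕ-injective (trans (sym (Fₚ.toℕ-inject j)) (trans (cong toℕ e) (Fₚ.toℕ-inject j′)))))

  collapse-outside : ∀ S r → Outsideᴾ r → collapse S r ≡ inj₂ (label S r)
  collapse-outside S (inj₁ i) refl with last-or-inject₁ (fromℕ (suc m′))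
  ... | inj₁ _       = refl
  ... | inj₂ (j , e) = ⊥-elim (Fₚ.fromℕ≢inject₁ e)
  collapse-outside S (inj₂ j) k≤j with below-or-inject k j
  ... | inj₁ _          = refl
  ... | inj₂ (j′ , refl) = ⊥-elim (≰-inject k j′ k≤j)

  extend : Subset G → Partition U⁻ → Partition U
  extend S σ = pullback (collapse S) (σ ⊎ᴾ discreteℕ)

  module _ (S : Subset G) (σ : Partition U⁻) where

    rel-extend-embed : ∀ u v → rel (extend S σ) (embedᴾ u) (embedᴾ v) ≡ rel σ u v
    rel-extend-embed u v = cong₂ (relᵘ σ discreteℕ) (collapse-embed S u) (collapse-embed S v)

    rel-extend-outside : ∀ r r′ → Outsideᴾ r → Outsideᴾ r′ → rel (extend S σ) r r′ ≡ (label S r ℕ.≡ᵇ label S r′)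
    rel-extend-outside r r′ out out′ = cong₂ (relᵘ σ discreteℕ) (collapse-outside S r out) (collapse-outside S r′ out′)

    rel-extend-outside-embed : ∀ r u → Outsideᴾ r → rel (extend S σ) r (embedᴾ u) ≡ false
    rel-extend-outside-embed r u out = cong₂ (relᵘ σ discreteℕ) (collapse-outside S r out) (collapse-embed S u)

    rel-extend-embed-outside : ∀ u r → Outsideᴾ r → rel (extend S σ) (embedᴾ u) r ≡ false
    rel-extend-embed-outside u r out = cong₂ (relᵘ σ discreteℕ) (collapse-embed S u) (collapse-outside S r out)

    outside-closed : ∀ r r′ → Outsideᴾ r → rel (extend S σ) r r′ ≡ true → Outsideᴾ r′
    outside-closed r r′ out r~r′ with coverᴾ r′
    ... | inj₁ out′       = out′
    ... | inj₂ (w , refl) = ⊥-elim (not-¬ r~r′ (rel-extend-outside-embed r w out))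

    label-cong : ∀ r r′ → Outsideᴾ r → Outsideᴾ r′ → rel (extend S σ) r r′ ≡ true → label S r ≡ label S r′
    label-cong r r′ out out′ r~r′ = ≡ᵇ-true⇒≡ _ _ (trans (sym (rel-extend-outside r r′ out out′)) r~r′)

    extend-InB : InB k (extend S σ)
    extend-InB = trans (rel-extend-outside x-last (y k) refl ℕₚ.≤-refl) (cong (λ t → 0 ℕ.≡ᵇ cuts S t) (ℕₚ.n∸n≡0 K)) ,
                 rel-extend-outside-embed x-last (inj₁ (fromℕ m′)) refl ,
                 below-k
      where
      below-k : ∀ j → j F.< k → rel (extend S σ) x-last (y j) ≡ false
      below-k j j<k = [ (λ k≤j → ⊥-elim (ℕₚ.<⇒≱ j<k k≤j)) , lower ]′ (below-or-inject k j)
        where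
        lower : ∃ (λ j′ → j ≡ inject j′) → rel (extend S σ) x-last (y j) ≡ false
        lower (j′ , refl) = rel-extend-outside-embed x-last (inj₂ j′) refl

    extend-joined-gaps : ∀ g → rel (extend S σ) (y (inject₁ (gap g))) (y (suc (gap g))) ≡ lookup S g
    extend-joined-gaps g = begin
      rel (extend S σ) (y (inject₁ (gap g))) (y (suc (gap g)))
        ≡⟨ rel-extend-outside (y (inject₁ (gap g))) (y (suc (gap g))) K≤lo K≤hi ⟩
      (cuts S (toℕ (inject₁ (gap g)) ∸ K) ℕ.≡ᵇ cuts S (suc (toℕ (gap g)) ∸ K))
        ≡⟨ cong₂ (λ u v → cuts S u ℕ.≡ᵇ cuts S v) position-lo position-hi ⟩
      (cuts S (toℕ g) ℕ.≡ᵇ cuts S (suc (toℕ g)))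
        ≡⟨ cuts-gap S g ⟩
      lookup S g ∎
      where
      open ≡-Reasoning
      K≤lo : K ℕ.≤ toℕ (inject₁ (gap g))
      K≤lo = subst (K ℕ.≤_) (sym (trans (Fₚ.toℕ-inject₁ (gap g)) (toℕ-gap g))) (ℕₚ.m≤m+n K (toℕ g))
      K≤hi : K ℕ.≤ suc (toℕ (gap g))
      K≤hi = ℕₚ.m≤n⇒m≤1+n (subst (K ℕ.≤_) (sym (toℕ-gap g)) (ℕₚ.m≤m+n K (toℕ g)))
      position-lo : toℕ (inject₁ (gap g)) ∸ K ≡ toℕ g
      position-lo = trans (cong (_∸ K) (trans (Fₚ.toℕ-inject₁ (gap g)) (toℕ-gap g))) (ℕₚ.m+n∸m≡n K (toℕ g))
      position-hi : suc (toℕ (gap g)) ∸ K ≡ suc (toℕ g)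
      position-hi = trans (cong (λ t → suc t ∸ K) (toℕ-gap g))
                          (trans (cong (_∸ K) (sym (ℕₚ.+-suc K (toℕ g)))) (ℕₚ.m+n∸m≡n K (suc (toℕ g))))

    private
      ρ : Partition U
      ρ = extend S σ

    X : ℚ
    X = xs (fromℕ (suc m′))

    -- the line through x_m and y_k
    upper-lower-separated : ∀ p → Outsideᴾ p → ∀ v → ¬ HullsMeet xs bs ρ p (embedᴾ v)
    upper-lower-separated p out v = separated⇒¬HullsMeet ρ (bs k) X (X * bs k) p (embedᴾ v) on-upper on-lower
      where
      0<X : 0ℚ < X
      0<X = 0<xs (fromℕ (suc m′))
      on-upper : ∀ r → rel ρ p r ≡ true → X * bs k ≤ linear (bs k) X r
      on-upper r p~r with outside-closed p r out p~r
      on-upper (inj₁ i) _ | refl = ≤-reflexive (sym (trans (linear-x (bs k) X _) (*-comm (bs k) X)))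
      on-upper (inj₂ j) _ | k≤j = subst (X * bs k ≤_) (sym (linear-y (bs k) X j))
        (*-monoʳ-≤-0≤ (<⇒≤ 0<X) (strictly-increasing⇒≤ bs bs-mono (ℕₚ.≤⇒≯ k≤j)))
      on-lower : ∀ r → rel ρ (embedᴾ v) r ≡ true → linear (bs k) X r < X * bs k
      on-lower r v~r with coverᴾ r
      ... | inj₁ out′ = ⊥-elim (not-¬ v~r (rel-extend-embed-outside v r out′))
      ... | inj₂ (inj₁ i , refl) = subst₂ _<_ (sym (linear-x (bs k) X _)) (*-comm (bs k) X)
        (*-monoʳ-<-0< (0<bs k) (xs-mono (inject₁<fromℕ i)))
      ... | inj₂ (inj₂ j , refl) = subst (_< X * bs k) (sym (linear-y (bs k) X _))
        (*-monoʳ-<-0< 0<X (bs-mono (inject<k j)))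

    -- the horizontal line through the lowest point y_c of the block of q
    upper-upper-separated : ∀ p q → Outsideᴾ p → Outsideᴾ q → label S p ℕ.< label S q → ¬ HullsMeet xs bs ρ q p
    upper-upper-separated p (inj₁ i) _ refl lp<lq = ⊥-elim (ℕₚ.n≮0 lp<lq)
    upper-upper-separated p (inj₂ j₀) out k≤j₀ lp<lq with first-true (λ j → rel ρ (y j₀) (y j))
    ... | inj₁ none = ⊥-elim (not-¬ (rel-refl ρ (y j₀)) (none j₀))
    ... | inj₂ (c , q~c , c-first) = separated⇒¬HullsMeet ρ 0ℚ 1ℚ (bs c) (y j₀) p on-q on-p
      where
      q = y j₀
      c-out : Outsideᴾ (y c)
      c-out = outside-closed q (y c) k≤j₀ q~c
      on-q : ∀ r → rel ρ q r ≡ true → bs c ≤ linear 0ℚ 1ℚ r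
      on-q r q~r with outside-closed q r k≤j₀ q~r
      on-q (inj₁ i) q~r | refl = ⊥-elim (ℕₚ.n≮0 (subst (label S p ℕ.<_) (label-cong q x-last k≤j₀ refl q~r) lp<lq))
      on-q (inj₂ j) q~r | _ = subst (bs c ≤_) (sym (trans (linear-y 0ℚ 1ℚ j) (*-identityˡ (bs j))))
        (strictly-increasing⇒≤ bs bs-mono (λ j<c → not-¬ q~r (c-first j j<c)))
      on-p : ∀ r → rel ρ p r ≡ true → linear 0ℚ 1ℚ r < bs c
      on-p r p~r with outside-closed p r out p~r
      on-p (inj₁ i) _ | refl = subst (_< bs c) (sym (trans (linear-x 0ℚ 1ℚ _) (*-zeroˡ X))) (0<bs c)
      on-p (inj₂ j) p~r | out-j = subst (_< bs c) (sym (trans (linear-y 0ℚ 1ℚ j) (*-identityˡ (bs j)))) (bs-mono j<c)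
        where
        labels : cuts S (toℕ j ∸ K) ℕ.< cuts S (toℕ c ∸ K)
        labels = subst₂ ℕ._<_ (label-cong p (y j) out out-j p~r) (label-cong q (y c) k≤j₀ c-out q~c) lp<lq
        j<c : j F.< c
        j<c = ℕₚ.≰⇒> (λ c≤j → ℕₚ.<⇒≱ labels (cuts-mono S (ℕₚ.∸-monoˡ-≤ K c≤j)))

    extend-NonCrossing : NonCrossing xs′ bs′ σ → NonCrossing xs bs ρ
    extend-NonCrossing ncσ p q p≁q meet with coverᴾ p | coverᴾ q
    ... | inj₂ (u , refl) | inj₂ (v , refl) =
      inside-blocks-separated ρ σ rel-extend-embed ncσ u v p≁q (inside u) (inside v) meet
      where
      inside : ∀ u r → rel ρ (embedᴾ u) r ≡ true → ¬ Outsideᴾ r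
      inside u r u~r out = not-¬ u~r (rel-extend-embed-outside u r out)
    ... | inj₁ out | inj₂ (v , refl) = upper-lower-separated p out v meet
    ... | inj₂ (u , refl) | inj₁ out = upper-lower-separated q out u (HullsMeet-sym ρ (embedᴾ u) q meet)
    ... | inj₁ out | inj₁ out′ with ℕₚ.<-cmp (label S p) (label S q)
    ...   | tri< lp<lq _ _ = upper-upper-separated p q out out′ lp<lq (HullsMeet-sym ρ p q meet)
    ...   | tri≈ _ lp≡lq _ = not-¬ (trans (rel-extend-outside p q out out′) (≡⇒≡ᵇ-true _ _ lp≡lq)) p≁q
    ...   | tri> _ _ lq<lp = upper-upper-separated q p out′ out lq<lp meet

  module _ (π : Partition U) (nc : NonCrossing xs bs π) (π∈B : InB k π) where

    lower≁last : ∀ w → rel π (embedᴾ w) x-last ≡ false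
    lower≁last (inj₁ i) = ¬-not (λ i~last → not-¬ (joins-prev π nc i (rel-sym π _ x-last i~last)) (proj₁ (proj₂ π∈B)))
    lower≁last (inj₂ j) = trans (rel-comm π _ x-last) (proj₂ (proj₂ π∈B) (inject j) (inject<k j))

    lower≁upper : ∀ w r → Outsideᴾ r → rel π (embedᴾ w) r ≡ false
    lower≁upper w (inj₁ i) refl = lower≁last w
    lower≁upper w (inj₂ j) k≤j = ¬-not (λ w~j → not-¬ (to-last w w~j (ℕₚ.m≤n⇒m<n∨m≡n k≤j)) (lower≁last w))
      where
      via-k : ∀ w → rel π (embedᴾ w) (y k) ≡ true → rel π (embedᴾ w) x-last ≡ true
      via-k w w~k = rel-trans π _ (y k) x-last w~k (rel-sym π x-last (y k) (proj₁ π∈B))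
      to-last : ∀ w → rel π (embedᴾ w) (y j) ≡ true → K ℕ.< toℕ j ⊎ K ≡ toℕ j → rel π (embedᴾ w) x-last ≡ true
      to-last w w~j (inj₂ K≡j) =
        via-k w (subst (λ z → rel π (embedᴾ w) (y z) ≡ true) (sym (Fₚ.toℕ-injective {i = k} {j = j} K≡j)) w~j)
      to-last (inj₁ i) i~j (inj₁ k<j) = xy-crossing π nc (inject₁<fromℕ i) k<j i~j (proj₁ π∈B)
      to-last (inj₂ i) i~j (inj₁ k<j) = via-k (inj₂ i) (y-between π nc (inject<k i) k<j i~j)

  -- x_m is represented by y_k, to which it is joined in B_k
  representative : ∀ r → Outsideᴾ r → Fin (suc n′)
  representative (inj₁ _) _ = k
  representative (inj₂ j) _ = j

  k≤representative : ∀ r out → K ℕ.≤ toℕ (representative r out)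
  k≤representative (inj₁ _) _   = ℕₚ.≤-refl
  k≤representative (inj₂ j) k≤j = k≤j

  rel-representative : ∀ (π : Partition U) → rel π x-last (y k) ≡ true →
    ∀ r out q out′ → rel π r q ≡ rel π (y (representative r out)) (y (representative q out′))
  rel-representative π last~k r out q out′ = begin
    rel π r q                                         ≡⟨ replace r out q ⟩
    rel π (y (representative r out)) q                ≡⟨ rel-comm π _ q ⟩
    rel π q (y (representative r out))                ≡⟨ replace q out′ _ ⟩
    rel π (y (representative q out′)) (y (representative r out)) ≡⟨ rel-comm π _ _ ⟩
    rel π (y (representative r out)) (y (representative q out′)) ∎
    where
    open ≡-Reasoning
    replace : ∀ r out q → rel π r q ≡ rel π (y (representative r out)) q
    replace (inj₁ i) refl q = rel-block π x-last (y k) q last~k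
    replace (inj₂ j) _    q = refl

  module _ {π μ : Partition U} (nc : NonCrossing xs bs π) (gaps⊆ : joined-gaps π ⊆ joined-gaps μ) where

    gap-step : ∀ l → K ℕ.≤ toℕ l → rel π (y (inject₁ l)) (y (suc l)) ≡ true →
               rel μ (y (inject₁ l)) (y (suc l)) ≡ true
    gap-step l K≤l l~l+1 = subst (λ l → rel μ (y (inject₁ l)) (y (suc l)) ≡ true) (gap-gap-of l K≤l)
      (∈-tabulate⁻ (λ g → rel μ (y (inject₁ (gap g))) (y (suc (gap g))))
        (gaps⊆ (∈-tabulate⁺ (λ g → rel π (y (inject₁ (gap g))) (y (suc (gap g))))
          (subst (λ l → rel π (y (inject₁ l)) (y (suc l)) ≡ true) (sym (gap-gap-of l K≤l)) l~l+1))))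

    -- a block of π among y_k, …, y_n is an interval, so its consecutive pairs are joined gaps
    upper-mono-≤ : ∀ i j → K ℕ.≤ toℕ i → toℕ i ℕ.≤ toℕ j →
                 rel π (y i) (y j) ≡ true → rel μ (y i) (y j) ≡ true
    upper-mono-≤ i j K≤i i≤j i~j = consecutive⇒rel μ y (toℕ j ∸ toℕ i) (sym (ℕₚ.m∸n+n≡m i≤j)) step
      where
      step : ∀ l → toℕ i ℕ.≤ toℕ l → toℕ l ℕ.< toℕ j → rel μ (y (inject₁ l)) (y (suc l)) ≡ true
      step l i≤l l<j = gap-step l (ℕₚ.≤-trans K≤i i≤l) (rel-trans π _ (y i) _ (rel-sym π (y i) _ i~l) i~l+1)
        where
        i~l : rel π (y i) (y (inject₁ l)) ≡ true
        i~l = y-interval π nc i~j (subst (toℕ i ℕ.≤_) (sym (Fₚ.toℕ-inject₁ l)) i≤l)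
                                  (subst (ℕ._≤ toℕ j) (sym (Fₚ.toℕ-inject₁ l)) (ℕₚ.<⇒≤ l<j))
        i~l+1 : rel π (y i) (y (suc l)) ≡ true
        i~l+1 = y-interval π nc i~j (ℕₚ.m≤n⇒m≤1+n i≤l) l<j

    upper-mono : ∀ i j → K ℕ.≤ toℕ i → K ℕ.≤ toℕ j →
                  rel π (y i) (y j) ≡ true → rel μ (y i) (y j) ≡ true
    upper-mono i j K≤i K≤j i~j with ℕₚ.≤-total (toℕ i) (toℕ j)
    ... | inj₁ i≤j = upper-mono-≤ i j K≤i i≤j i~j
    ... | inj₂ j≤i = rel-sym μ (y j) (y i) (upper-mono-≤ j i K≤j j≤i (rel-sym π (y i) (y j) i~j))

  PieceB : Poset 0ℓ 0ℓ 0ℓ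
  PieceB = SubPoset (NC xs bs) (λ π → InB k (proj₁ π))

  Model : Poset 0ℓ 0ℓ 0ℓ
  Model = NC xs′ bs′ ×ᴾ BoolPoset G

  restrictB : Poset.Carrier PieceB → Poset.Carrier Model
  restrictB ((π , nc) , _) = (pullback embedᴾ π , restrict-NonCrossing π nc) , joined-gaps π

  extendB : Poset.Carrier Model → Poset.Carrier PieceB
  extendB ((σ , ncσ) , S) = (extend S σ , extend-NonCrossing S σ ncσ) , extend-InB S σ

  restrictB∘extendB : ∀ τ → Poset._≈_ Model (restrictB (extendB τ)) τ
  restrictB∘extendB ((σ , _) , S) =
    rel-extend-embed S σ , trans (Vₚ.tabulate-cong (extend-joined-gaps S σ)) (Vₚ.tabulate∘lookup S)

  restrictB-mono : ∀ {π μ} → Poset._≤_ PieceB π μ → Poset._≤_ Model (restrictB π) (restrictB μ)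
  restrictB-mono {(π , _) , _} {(μ , _) , _} π≤μ =
    (λ u v → π≤μ (embedᴾ u) (embedᴾ v)) ,
    λ g∈ → ∈-tabulate⁺ (λ g → rel μ (y (inject₁ (gap g))) (y (suc (gap g))))
             (π≤μ _ _ (∈-tabulate⁻ (λ g → rel π (y (inject₁ (gap g))) (y (suc (gap g)))) g∈))

  restrictB-cancel : ∀ {π μ} → Poset._≤_ Model (restrictB π) (restrictB μ) → Poset._≤_ PieceB π μ
  restrictB-cancel {(π , nc) , π∈B} {(μ , _) , μ∈B} (π≤μ⁻ , gaps⊆) p q p~q with coverᴾ p | coverᴾ q
  ... | inj₂ (u , refl) | inj₂ (v , refl) = π≤μ⁻ u v p~q
  ... | inj₂ (u , refl) | inj₁ out = ⊥-elim (not-¬ p~q (lower≁upper π nc π∈B u q out))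
  ... | inj₁ out | inj₂ (v , refl) = ⊥-elim (not-¬ (rel-sym π p _ p~q) (lower≁upper π nc π∈B v p out))
  ... | inj₁ out | inj₁ out′ =
    trans (rel-representative μ (proj₁ μ∈B) p out q out′)
      (upper-mono {π} {μ} nc gaps⊆ _ _ (k≤representative p out) (k≤representative q out′)
        (trans (sym (rel-representative π (proj₁ π∈B) p out q out′)) p~q))

  PieceB≅ : PieceB ≅ Model
  PieceB≅ = order-isomorphism PieceB Model restrictB
              (λ {π} {μ} → restrictB-mono {π} {μ}) (λ {π} {μ} → restrictB-cancel {π} {μ})
              extendB restrictB∘extendB

lemma3p1 : (m' n' : ℕ) (xs : Fin (suc (suc m')) → ℚ) (bs : Fin (suc n') → ℚ) →
    StrictlyIncreasingPos xs → StrictlyIncreasingPos bs →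
    (SubPoset (NC xs bs) (λ π → InA (proj₁ π))
       ≅ (NC (λ i → xs (inject₁ i)) bs ×ᴾ BoolPoset 1))
    × (∀ (k : Fin (suc n')) →
         SubPoset (NC xs bs) (λ π → InB k (proj₁ π))
           ≅ (NC (λ i → xs (inject₁ i)) (λ (j : Fin (toℕ k)) → bs (inject j))
                ×ᴾ BoolPoset (suc n' ∸ suc (toℕ k))))
    × (∀ (π : Poset.Carrier (NC xs bs)) →
         (InA (proj₁ π) ⊎ ∃ (λ k → InB k (proj₁ π)))
         × (∀ k → InA (proj₁ π) → InB k (proj₁ π) → ⊥)
         × (∀ k l → InB k (proj₁ π) → InB l (proj₁ π) → k ≡ l))
lemma3p1 m′ n′ xs bs xs↑ bs↑ =
  PieceA.PieceA≅ m′ n′ xs bs xs↑ bs↑ ,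
  PieceB.PieceB≅ m′ n′ xs bs xs↑ bs↑ ,
  λ (π , nc) → InA⊎InB π nc , ¬InA×InB π , InB-unique π
  where open Setting m′ n′ xs bs xs↑ bs↑
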